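{- For all integers $n\ge 2$ and $1\le d\le n-1$, the polynomial $$g_{n,d}(t)=\sum_{i=1}^{\min(d,n-d)} \frac{(n-i-1)!}{(d-i)!\,(n-d-i)!\,(i-1)!}\, t^i$$ has only real zeros.
   Context: $g_{n,d}(t)$ is Speyer's $g$-polynomial of the uniform matroid $U_{n,d}$ of rank $d$ on $n$ elements; in this statement it is simply the explicit polynomial displayed. -}

module Defs where

open import Level using (Level; _⊔_) renaming (suc to lsuc)
open import Data.Nat as ℕ using (ℕ; zero; suc; _∸_; _⊓_; _!; NonZero)
open import Data.Nat.DivMod using (_/_)
open import Data.Nat.Properties using (_!≢0; m*n≢0)
open import Data.List using (List; []; _∷_; map; upTo)
open import Data.Product using (Σ; ∃; _×_)
open import Relation.Nullary using (¬_)
open import Relation.Binary.Structures using (IsTotalOrder)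
open import Algebra.Bundles using (CommutativeRing)

-- The coefficients of Speyer's g-polynomial of U_{n,d}:
--   [t^i] g_{n,d} = (n-i-1)! / ((d-i)! (n-d-i)! (i-1)!)   for 1 ≤ i ≤ min(d,n-d)
--   [t^0] g_{n,d} = 0

gcoef : ℕ → ℕ → ℕ → ℕ
gcoef n d zero    = 0
gcoef n d (suc j) =
  _/_ ((n ∸ suc j ∸ 1) !) (((d ∸ suc j) ! ℕ.* (n ∸ d ∸ suc j) !) ℕ.* j !)
      {{m*n≢0 _ _ {{m*n≢0 _ _ {{(d ∸ suc j) !≢0}} {{(n ∸ d ∸ suc j) !≢0}}}} {{j !≢0}}}}

gPoly : ℕ → ℕ → List ℕ
gPoly n d = map (gcoef n d) (upTo (suc (d ⊓ (n ∸ d))))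

-- The real numbers, axiomatised as a complete ordered field
-- (unique up to isomorphism, so this is "ℝ").

record RealField (c ℓ₁ ℓ₂ : Level) : Set (lsuc (c ⊔ ℓ₁ ⊔ ℓ₂)) where
  field
    commRing : CommutativeRing c ℓ₁
  open CommutativeRing commRing public
  field
    _≤_          : Carrier → Carrier → Set ℓ₂
    isTotalOrder : IsTotalOrder _≈_ _≤_
    0≉1          : ¬ (0# ≈ 1#)
    inverse      : ∀ x → ¬ (x ≈ 0#) → ∃ λ y → x * y ≈ 1#
    +-mono-≤     : ∀ {x y} z → x ≤ y → (x + z) ≤ (y + z)
    *-nonneg     : ∀ {x y} → 0# ≤ x → 0# ≤ y → 0# ≤ (x * y)
    lub          : (P : Carrier → Set (c ⊔ ℓ₁ ⊔ ℓ₂)) → ∃ P →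
                   (∃ λ b → ∀ x → P x → x ≤ b) →
                   ∃ λ s → (∀ x → P x → x ≤ s) ×
                           (∀ b → (∀ x → P x → x ≤ b) → s ≤ b)

module _ {c ℓ₁ ℓ₂} (R : RealField c ℓ₁ ℓ₂) where
  open RealField R

  ι : ℕ → Carrier
  ι zero    = 0#
  ι (suc n) = 1# + ι n

  eval : List ℕ → Carrier → Carrier
  eval []       x = 0#
  eval (a ∷ as) x = ι a + x * eval as x

  linProd : List Carrier → Carrier → Carrier
  linProd []       x = 1#
  linProd (r ∷ rs) x = (x - r) * linProd rs x

  -- p has only real zeros: p splits into linear factors over R
  OnlyRealZeros : List ℕ → Set (c ⊔ ℓ₁)
  OnlyRealZeros p = Σ Carrier λ a → Σ (List Carrier) λ rs →
                      ∀ x → eval p x ≈ a * linProd rs x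

-- Write d = a + 1 and n = a + b + 2. The coefficient of t^(j+1) in g_{n,d} is
-- (a + b − j)! / ((a − j)! (b − j)! j!) = (b C j) ((a + b − j) C (a − j)), which is symmetric in
-- a and b; so for a ≤ b we get g(t) = t E_a(t), where E_k(z) = Σⱼ (b C j) ((a + b − j) C (k − j)) zʲ
-- has degree k and a positive leading coefficient for k ≤ b. Pascal's rule in b,
-- E_{k+1}^{b+1} = E_{k+1}^b + (1 + z) E_k^b, gives by induction on b the three-term recurrence
-- (k + 1) E_{k+1} = ((a − k) + (b − k)(1 + z)) E_k + (a + b + 1 − k)(1 + z) E_{k−1},
-- and also E_k(−1) = a C k > 0 for k ≤ a. At a root u < −1 of E_k the recurrence gives E_{k+1}(u) and
-- E_{k−1}(u) opposite signs. So, by induction on k, if the roots of E_k are real, below −1 and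
-- interlaced by those of E_{k−1}, then E_{k+1} changes sign between consecutive roots of E_k and
-- between the largest one and −1. The intermediate value theorem (obtained from completeness by
-- bisection) gives k roots of E_{k+1} there, and after dividing them out what is left is a linear
-- factor, whose root lies below the smallest root of E_k.

module Submission where

open import Defs hiding (ι)
open import Level using (Level; _⊔_; Lift; lift)
open import Algebra.Bundles using (CommutativeRing)
open import Algebra.Solver.Ring.AlmostCommutativeRing using (fromCommutativeRing; _-Raw-AlmostCommutative⟶_)
import Algebra.Solver.Ring
open import Data.Nat as ℕ using (ℕ; zero; suc; z≤n; s≤s)
import Data.Nat.Properties as ℕ
open import Data.Nat.Combinatorics using (_C_)
open import Data.Sign as Sign using (Sign)
open import Data.Maybe using (Maybe; just; nothing)
open import Data.List using (List; []; _∷_; length; map; upTo; applyUpTo)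
open import Data.List.Properties using (map-upTo; length-applyUpTo)
open import Data.List.Relation.Unary.All as All using (All; []; _∷_)
open import Data.List.Relation.Unary.AllPairs as AllPairs using (AllPairs; []; _∷_)
open import Data.Product using (Σ; ∃; _×_; _,_; proj₁; proj₂)
open import Data.Sum using (_⊎_; inj₁; inj₂)
open import Data.Empty using (⊥-elim)
open import Relation.Nullary using (¬_; yes; no)
open import Relation.Binary.PropositionalEquality as ≡ using (_≡_)
open import Relation.Binary.Structures using (IsTotalOrder)

module Binomial where
  open import Data.Nat
  open import Data.Nat.Properties
  open import Data.Nat.Combinatorics using (nCk+nC[k+1]≡[n+1]C[k+1]; nC1≡n; k>n⇒nCk≡0; nCk≡n!/k![n-k]!; k![n∸k]!∣n!)
  open import Data.Nat.DivMod using (m/n*n≡m; m*n/n≡m; /-congˡ)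
  open import Data.Nat.Tactic.RingSolver using (solve-∀)
  open import Relation.Binary.PropositionalEquality
  open ≡-Reasoning

  -- M C (k − j) with k − j taken in ℤ, hence zero for j > k
  _C[_⊖_] : ℕ → ℕ → ℕ → ℕ
  M C[ k     ⊖ zero  ] = M C k
  M C[ zero  ⊖ suc j ] = 0
  M C[ suc k ⊖ suc j ] = M C[ k ⊖ j ]

  C[⊖]-pascal : ∀ M k j → (suc M) C[ k ⊖ j ] ≡ M C[ k ⊖ j ] + M C[ k ⊖ suc j ]
  C[⊖]-pascal M zero    zero    = refl
  C[⊖]-pascal M (suc k) zero    = trans (sym (nCk+nC[k+1]≡[n+1]C[k+1] M k)) (+-comm (M C k) _)
  C[⊖]-pascal M zero    (suc j) = refl
  C[⊖]-pascal M (suc k) (suc j) = C[⊖]-pascal M k j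

  C[k⊖k]≡1 : ∀ M k → M C[ k ⊖ k ] ≡ 1
  C[k⊖k]≡1 M zero    = refl
  C[k⊖k]≡1 M (suc k) = C[k⊖k]≡1 M k

  C[k⊖1+k]≡0 : ∀ M k → M C[ k ⊖ suc k ] ≡ 0
  C[k⊖1+k]≡0 M zero    = refl
  C[k⊖1+k]≡0 M (suc k) = C[k⊖1+k]≡0 M k

  C[⊖]≡C∸ : ∀ M {k j} → j ≤ k → M C[ k ⊖ j ] ≡ M C (k ∸ j)
  C[⊖]≡C∸ M {k} z≤n       = refl
  C[⊖]≡C∸ M (s≤s j≤k) = C[⊖]≡C∸ M j≤k

  coeffE : ℕ → ℕ → ℕ → ℕ → ℕ
  coeffE a b k j = (b C j) * (((b ∸ j) + a) C[ k ⊖ j ])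

  shift : (ℕ → ℕ) → ℕ → ℕ
  shift f zero    = 0
  shift f (suc j) = f j

  coeffE-pascal : ∀ a b k j →
    coeffE a (suc b) (suc k) j ≡ coeffE a b (suc k) j + (coeffE a b k j + shift (coeffE a b k) j)
  coeffE-pascal a b k zero = begin
    1 * (suc (b + a) C suc k)                     ≡⟨ cong (1 *_) (nCk+nC[k+1]≡[n+1]C[k+1] (b + a) k) ⟨
    1 * (((b + a) C k) + ((b + a) C suc k))       ≡⟨ rearrange ((b + a) C k) _ ⟩
    1 * ((b + a) C suc k) + (1 * ((b + a) C k) + 0) ∎
    where
    rearrange : ∀ x y → 1 * (x + y) ≡ 1 * y + (1 * x + 0)
    rearrange = solve-∀
  coeffE-pascal a b k (suc j) = begin
    (suc b C suc j) * X₀                      ≡⟨ cong (_* X₀) (nCk+nC[k+1]≡[n+1]C[k+1] b j) ⟨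
    (Bⱼ + B₁₊ⱼ) * X₀                          ≡⟨ *-distribʳ-+ X₀ Bⱼ B₁₊ⱼ ⟩
    Bⱼ * X₀ + B₁₊ⱼ * X₀                       ≡⟨ cong (Bⱼ * X₀ +_) B₁₊ⱼ*X₀≡B₁₊ⱼ*[X₁+Y₁] ⟩
    Bⱼ * X₀ + B₁₊ⱼ * (X₁ + Y₁)                ≡⟨ rearrange (Bⱼ * X₀) B₁₊ⱼ X₁ Y₁ ⟩
    B₁₊ⱼ * X₁ + (B₁₊ⱼ * Y₁ + Bⱼ * X₀)         ∎
    where
    Bⱼ   = b C j
    B₁₊ⱼ = b C suc j
    X₀ = ((b ∸ j) + a) C[ k ⊖ j ]
    X₁ = ((b ∸ suc j) + a) C[ k ⊖ j ]
    Y₁ = ((b ∸ suc j) + a) C[ k ⊖ suc j ]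
    B₁₊ⱼ*X₀≡B₁₊ⱼ*[X₁+Y₁] : B₁₊ⱼ * X₀ ≡ B₁₊ⱼ * (X₁ + Y₁)
    B₁₊ⱼ*X₀≡B₁₊ⱼ*[X₁+Y₁] with j <? b
    ... | yes j<b = cong (B₁₊ⱼ *_) (trans (cong (λ M → (M + a) C[ k ⊖ j ]) (+-∸-assoc 1 j<b)) (C[⊖]-pascal _ k j))
    ... | no  j≮b = trans (cong (_* X₀) B₁₊ⱼ≡0) (sym (cong (_* (X₁ + Y₁)) B₁₊ⱼ≡0))
      where
      B₁₊ⱼ≡0 : B₁₊ⱼ ≡ 0
      B₁₊ⱼ≡0 = k>n⇒nCk≡0 (s≤s (≮⇒≥ j≮b))
    rearrange : ∀ z y p q → z + y * (p + q) ≡ y * p + (y * q + z)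
    rearrange = solve-∀

  [1+k]*nC[1+k]+k*nCk≡n*nCk : ∀ n k → suc k * (n C suc k) + k * (n C k) ≡ n * (n C k)
  [1+k]*nC[1+k]+k*nCk≡n*nCk zero    zero    = refl
  [1+k]*nC[1+k]+k*nCk≡n*nCk zero    (suc k) = cong₂ _+_ (*-zeroʳ (suc (suc k))) (*-zeroʳ (suc k))
  [1+k]*nC[1+k]+k*nCk≡n*nCk (suc n) zero    = trans (+-identityʳ _) (trans (+-identityʳ _) (trans (nC1≡n (suc n)) (sym (*-identityʳ (suc n)))))
  [1+k]*nC[1+k]+k*nCk≡n*nCk (suc n) (suc k) = begin
    suc (suc k) * (suc n C suc (suc k)) + suc k * (suc n C suc k)
      ≡⟨ cong₂ (λ x y → suc (suc k) * x + suc k * y) (nCk+nC[k+1]≡[n+1]C[k+1] n (suc k)) (nCk+nC[k+1]≡[n+1]C[k+1] n k) ⟨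
    suc (suc k) * (C₁ + C₂) + suc k * (C₀ + C₁)
      ≡⟨ rearrange k C₀ C₁ C₂ ⟩
    (suc (suc k) * C₂ + suc k * C₁) + (suc k * C₁ + k * C₀) + (C₀ + C₁)
      ≡⟨ cong₂ (λ x y → x + y + (C₀ + C₁)) ([1+k]*nC[1+k]+k*nCk≡n*nCk n (suc k)) ([1+k]*nC[1+k]+k*nCk≡n*nCk n k) ⟩
    n * C₁ + n * C₀ + (C₀ + C₁)
      ≡⟨ collect n C₀ C₁ ⟩
    suc n * (C₀ + C₁)
      ≡⟨ cong (suc n *_) (nCk+nC[k+1]≡[n+1]C[k+1] n k) ⟩
    suc n * (suc n C suc k) ∎
    where
    C₀ = n C k
    C₁ = n C suc k
    C₂ = n C suc (suc k)
    rearrange : ∀ k C₀ C₁ C₂ → suc (suc k) * (C₁ + C₂) + suc k * (C₀ + C₁) ≡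
                               (suc (suc k) * C₂ + suc k * C₁) + (suc k * C₁ + k * C₀) + (C₀ + C₁)
    rearrange = solve-∀
    collect : ∀ n C₀ C₁ → n * C₁ + n * C₀ + (C₀ + C₁) ≡ suc n * (C₀ + C₁)
    collect = solve-∀

  nCk*k![n∸k]!≡n! : ∀ {n k} → k ≤ n → (n C k) * (k ! * (n ∸ k) !) ≡ n !
  nCk*k![n∸k]!≡n! {n} {k} k≤n = begin
    (n C k) * (k ! * (n ∸ k) !)                    ≡⟨ cong (_* (k ! * (n ∸ k) !)) (nCk≡n!/k![n-k]! k≤n) ⟩
    n ! / (k ! * (n ∸ k) !) * (k ! * (n ∸ k) !)   ≡⟨ m/n*n≡m (k![n∸k]!∣n! k≤n) ⟩
    n ! ∎
    where
    instance
      k![n∸k]!≢0 : NonZero (k ! * (n ∸ k) !)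
      k![n∸k]!≢0 = m*n≢0 (k !) ((n ∸ k) !) {{k !≢0}} {{(n ∸ k) !≢0}}

  coeffE-multinomial : ∀ {a b j} → j ≤ a → a ≤ b → coeffE a b a j * (((a ∸ j) ! * (b ∸ j) !) * j !) ≡ (a + b ∸ j) !
  coeffE-multinomial {a} {b} {j} j≤a a≤b = begin
    ((b C j) * (M C[ a ⊖ j ])) * ((x ! * (b ∸ j) !) * j !)  ≡⟨ cong (λ y → ((b C j) * y) * ((x ! * (b ∸ j) !) * j !)) (C[⊖]≡C∸ M j≤a) ⟩
    ((b C j) * (M C x)) * ((x ! * (b ∸ j) !) * j !)         ≡⟨ rearrange (b C j) (M C x) (x !) ((b ∸ j) !) (j !) ⟩
    (M C x) * (x ! * ((b C j) * (j ! * (b ∸ j) !)))          ≡⟨ cong (λ y → (M C x) * (x ! * y)) (nCk*k![n∸k]!≡n! j≤b) ⟩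
    (M C x) * (x ! * b !)                                    ≡⟨ cong (λ y → (M C x) * (x ! * y !)) M∸x≡b ⟨
    (M C x) * (x ! * (M ∸ x) !)                              ≡⟨ nCk*k![n∸k]!≡n! (subst (x ≤_) (sym M≡b+x) (m≤n+m x b)) ⟩
    M !                                                      ≡⟨ cong _! M≡a+b∸j ⟩
    (a + b ∸ j) !                                            ∎
    where
    x = a ∸ j
    j≤b : j ≤ b
    j≤b = ≤-trans j≤a a≤b
    M = (b ∸ j) + a
    M≡b+x : M ≡ b + x
    M≡b+x = begin
      (b ∸ j) + a               ≡⟨ cong ((b ∸ j) +_) (m+[n∸m]≡n j≤a) ⟨
      (b ∸ j) + (j + x)         ≡⟨ +-assoc (b ∸ j) j x ⟨
      ((b ∸ j) + j) + x         ≡⟨ cong (_+ x) (m∸n+n≡m j≤b) ⟩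
      b + x                     ∎
    M∸x≡b : M ∸ x ≡ b
    M∸x≡b = trans (cong (_∸ x) M≡b+x) (m+n∸n≡m b x)
    M≡a+b∸j : M ≡ a + b ∸ j
    M≡a+b∸j = sym (trans (+-∸-assoc a j≤b) (+-comm a (b ∸ j)))
    rearrange : ∀ B C X Y J → (B * C) * ((X * Y) * J) ≡ C * (X * (B * (J * Y)))
    rearrange = solve-∀

  gcoef-from-multinomial : ∀ {a b j} V → j ≤ a → j ≤ b → V * (((a ∸ j) ! * (b ∸ j) !) * j !) ≡ (a + b ∸ j) ! →
                           gcoef (suc a + suc b) (suc a) (suc j) ≡ V
  gcoef-from-multinomial {a} {b} {j} V j≤a j≤b V*D≡N = begin
    N / D          ≡⟨ /-congˡ N≡V*D ⟩
    (V * D) / D    ≡⟨ m*n/n≡m V D ⟩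
    V              ∎
    where
    N = (suc a + suc b ∸ suc j ∸ 1) !
    D = ((a ∸ j) ! * (suc a + suc b ∸ suc a ∸ suc j) !) * j !
    instance
      D≢0 : NonZero D
      D≢0 = m*n≢0 ((a ∸ j) ! * (suc a + suc b ∸ suc a ∸ suc j) !) (j !)
              {{m*n≢0 ((a ∸ j) !) _ {{(a ∸ j) !≢0}} {{(suc a + suc b ∸ suc a ∸ suc j) !≢0}}}} {{j !≢0}}
    N≡V*D : N ≡ V * D
    N≡V*D = begin
      (suc a + suc b ∸ suc j ∸ 1) !                     ≡⟨ cong (λ m → (m ∸ j ∸ 1) !) (+-suc a b) ⟩
      (suc (a + b) ∸ j ∸ 1) !                           ≡⟨ cong (λ m → (m ∸ 1) !) (+-∸-assoc 1 (≤-trans j≤a (m≤m+n a b))) ⟩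
      (a + b ∸ j) !                                     ≡⟨ V*D≡N ⟨
      V * (((a ∸ j) ! * (b ∸ j) !) * j !)               ≡⟨ cong (λ m → V * (((a ∸ j) ! * (m ∸ suc j) !) * j !)) (m+n∸m≡n a (suc b)) ⟨
      V * D                                             ∎

  gcoef≡coeffE : ∀ {a b j} → j ≤ a → a ≤ b → gcoef (suc a + suc b) (suc a) (suc j) ≡ coeffE a b a j
  gcoef≡coeffE j≤a a≤b = gcoef-from-multinomial _ j≤a (≤-trans j≤a a≤b) (coeffE-multinomial j≤a a≤b)

  gcoef≡coeffE-swapped : ∀ {a b j} → j ≤ b → b ≤ a → gcoef (suc a + suc b) (suc a) (suc j) ≡ coeffE b a b j
  gcoef≡coeffE-swapped {a} {b} {j} j≤b b≤a = gcoef-from-multinomial _ (≤-trans j≤b b≤a) j≤b (begin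
    coeffE b a b j * (((a ∸ j) ! * (b ∸ j) !) * j !)   ≡⟨ cong (λ d → coeffE b a b j * (d * j !)) (*-comm ((a ∸ j) !) _) ⟩
    coeffE b a b j * (((b ∸ j) ! * (a ∸ j) !) * j !)   ≡⟨ coeffE-multinomial j≤b b≤a ⟩
    (b + a ∸ j) !                                       ≡⟨ cong (λ m → (m ∸ j) !) (+-comm b a) ⟩
    (a + b ∸ j) !                                       ∎)

  nCk>0 : ∀ {n k} → k ≤ n → n C k > 0
  nCk>0 {n} {k} k≤n = >-nonZero⁻¹ (n C k) {{m*n≢0⇒m≢0 (n C k) {{subst NonZero (sym (nCk*k![n∸k]!≡n! k≤n)) (n !≢0)}}}}

open Binomial

module _ {a} {A : Set a} where

  interleave : List A → List A → List A
  interleave []       ys = ys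
  interleave (x ∷ xs) ys = x ∷ interleave ys xs

  All-interleave⁻ : ∀ {p} {P : A → Set p} xs ys → All P (interleave xs ys) → All P xs × All P ys
  All-interleave⁻ []       ys Pys          = [] , Pys
  All-interleave⁻ (x ∷ xs) ys (Px ∷ Prest) with All-interleave⁻ ys xs Prest
  ... | Pys , Pxs = Px ∷ Pxs , Pys

  AllPairs-interleave⁻ : ∀ {ℓ} {_∼_ : A → A → Set ℓ} xs ys →
                         AllPairs _∼_ (interleave xs ys) → AllPairs _∼_ xs × AllPairs _∼_ ys
  AllPairs-interleave⁻ []       ys ∼ys             = [] , ∼ys
  AllPairs-interleave⁻ (x ∷ xs) ys (x∼rest ∷ ∼rest) with AllPairs-interleave⁻ ys xs ∼rest
  ... | ∼ys , ∼xs = proj₂ (All-interleave⁻ ys xs x∼rest) ∷ ∼xs , ∼ys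

open import Data.Integer as ℤ using (ℤ; +_; -[1+_]; _⊖_)
open import Data.Integer.Properties using ([1+m]⊖[1+n]≡m⊖n)

module IntegerSolver {c ℓ} (R : CommutativeRing c ℓ) where
  open CommutativeRing R
  open import Algebra.Properties.Ring ring using (-‿involutive; -0#≈0#; -‿distribˡ-*; -‿distribʳ-*; -‿+-comm)
  open import Algebra.Properties.Semiring.Mult.TCOptimised semiring using (×-homo-+; ×1-homo-*) renaming (_×_ to _×′_)
  open import Relation.Binary.Reasoning.Setoid setoid

  private
    -- The optimised ×′ has 1 ×′ x = x, so that the constant con (+ 1) evaluates to 1# itself.
    ι : ℕ → Carrier
    ι n = n ×′ 1#

    ⟦_⟧ : ℤ → Carrier
    ⟦ + n ⟧     = ι n
    ⟦ -[1+ n ] ⟧ = - ι (suc n)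

    1+x-[1+y]≈x-y : ∀ x y → (1# + x) - (1# + y) ≈ x - y
    1+x-[1+y]≈x-y x y = begin
      (1# + x) - (1# + y)       ≈⟨ +-congˡ (sym (-‿+-comm 1# y)) ⟩
      (1# + x) + (- 1# + - y)   ≈⟨ +-cong (+-comm 1# x) (+-comm (- 1#) (- y)) ⟩
      (x + 1#) + (- y + - 1#)   ≈⟨ +-assoc x 1# _ ⟩
      x + (1# + (- y + - 1#))   ≈⟨ +-congˡ (+-congˡ (+-comm (- y) (- 1#))) ⟩
      x + (1# + (- 1# + - y))   ≈⟨ +-congˡ (sym (+-assoc 1# (- 1#) (- y))) ⟩
      x + ((1# - 1#) + - y)     ≈⟨ +-congˡ (+-congʳ (-‿inverseʳ 1#)) ⟩
      x + (0# + - y)            ≈⟨ +-congˡ (+-identityˡ (- y)) ⟩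
      x - y                     ∎

    ι-suc : ∀ n → ι (suc n) ≈ 1# + ι n
    ι-suc n = ×-homo-+ 1# 1 n

    ⟦⊖⟧ : ∀ m n → ⟦ m ⊖ n ⟧ ≈ ι m - ι n
    ⟦⊖⟧ zero    zero    = sym (-‿inverseʳ 0#)
    ⟦⊖⟧ zero    (suc n) = sym (+-identityˡ _)
    ⟦⊖⟧ (suc m) zero    = sym (trans (+-congˡ -0#≈0#) (+-identityʳ _))
    ⟦⊖⟧ (suc m) (suc n) = begin
      ⟦ suc m ⊖ suc n ⟧      ≡⟨ ≡.cong ⟦_⟧ ([1+m]⊖[1+n]≡m⊖n m n) ⟩
      ⟦ m ⊖ n ⟧              ≈⟨ ⟦⊖⟧ m n ⟩
      ι m - ι n              ≈⟨ 1+x-[1+y]≈x-y (ι m) (ι n) ⟨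
      (1# + ι m) - (1# + ι n) ≈⟨ +-cong (ι-suc m) (-‿cong (ι-suc n)) ⟨
      ι (suc m) - ι (suc n)  ∎

    ⟦+⟧ : ∀ i j → ⟦ i ℤ.+ j ⟧ ≈ ⟦ i ⟧ + ⟦ j ⟧
    ⟦+⟧ (+ m)     (+ n)     = ×-homo-+ 1# m n
    ⟦+⟧ (+ m)     -[1+ n ]  = ⟦⊖⟧ m (suc n)
    ⟦+⟧ -[1+ m ]  (+ n)     = trans (⟦⊖⟧ n (suc m)) (+-comm _ _)
    ⟦+⟧ -[1+ m ]  -[1+ n ]  = begin
      - ι (suc (suc (m ℕ.+ n)))        ≡⟨ ≡.cong (λ k → - ι (suc k)) (ℕ.+-suc m n) ⟨
      - ι (suc m ℕ.+ suc n)            ≈⟨ -‿cong (×-homo-+ 1# (suc m) (suc n)) ⟩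
      - (ι (suc m) + ι (suc n))        ≈⟨ -‿+-comm _ _ ⟨
      - ι (suc m) + - ι (suc n)        ∎

    signed : Sign → Carrier → Carrier
    signed Sign.+ x = x
    signed Sign.- x = - x

    signed-cong : ∀ s {x y} → x ≈ y → signed s x ≈ signed s y
    signed-cong Sign.+ x≈y = x≈y
    signed-cong Sign.- x≈y = -‿cong x≈y

    signed-* : ∀ s t x y → signed (s Sign.* t) (x * y) ≈ signed s x * signed t y
    signed-* Sign.+ Sign.+ x y = refl
    signed-* Sign.+ Sign.- x y = -‿distribʳ-* x y
    signed-* Sign.- Sign.+ x y = -‿distribˡ-* x y
    signed-* Sign.- Sign.- x y = begin
      x * y          ≈⟨ -‿involutive (x * y) ⟨
      - - (x * y)    ≈⟨ -‿cong (-‿distribˡ-* x y) ⟩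
      - (- x * y)    ≈⟨ -‿distribʳ-* (- x) y ⟩
      - x * - y      ∎

    ⟦◃⟧ : ∀ s n → ⟦ s ℤ.◃ n ⟧ ≈ signed s (ι n)
    ⟦◃⟧ Sign.+ zero    = refl
    ⟦◃⟧ Sign.- zero    = sym -0#≈0#
    ⟦◃⟧ Sign.+ (suc n) = refl
    ⟦◃⟧ Sign.- (suc n) = refl

    ⟦*⟧ : ∀ i j → ⟦ i ℤ.* j ⟧ ≈ ⟦ i ⟧ * ⟦ j ⟧
    ⟦*⟧ i j = begin
      ⟦ (s Sign.* t) ℤ.◃ (∣i∣ ℕ.* ∣j∣) ⟧     ≈⟨ ⟦◃⟧ (s Sign.* t) (∣i∣ ℕ.* ∣j∣) ⟩
      signed (s Sign.* t) (ι (∣i∣ ℕ.* ∣j∣))  ≈⟨ signed-cong (s Sign.* t) (×1-homo-* ∣i∣ ∣j∣) ⟩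
      signed (s Sign.* t) (ι ∣i∣ * ι ∣j∣)     ≈⟨ signed-* s t (ι ∣i∣) (ι ∣j∣) ⟩
      signed s (ι ∣i∣) * signed t (ι ∣j∣)     ≈⟨ *-cong (⟦signAbs⟧ i) (⟦signAbs⟧ j) ⟨
      ⟦ i ⟧ * ⟦ j ⟧                           ∎
      where
      s = ℤ.sign i
      t = ℤ.sign j
      ∣i∣ = ℤ.∣ i ∣
      ∣j∣ = ℤ.∣ j ∣
      ⟦signAbs⟧ : ∀ k → ⟦ k ⟧ ≈ signed (ℤ.sign k) (ι ℤ.∣ k ∣)
      ⟦signAbs⟧ (+ n)     = refl
      ⟦signAbs⟧ -[1+ n ]  = refl

    ⟦-⟧ : ∀ i → ⟦ ℤ.- i ⟧ ≈ - ⟦ i ⟧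
    ⟦-⟧ (+ zero)   = sym -0#≈0#
    ⟦-⟧ (+ suc n)  = refl
    ⟦-⟧ -[1+ n ]   = sym (-‿involutive _)

    ℤ-morphism : ℤ.+-*-rawRing -Raw-AlmostCommutative⟶ fromCommutativeRing R
    ℤ-morphism = record
      { ⟦_⟧ = ⟦_⟧ ; +-homo = ⟦+⟧ ; *-homo = ⟦*⟧ ; -‿homo = ⟦-⟧ ; 0-homo = refl ; 1-homo = refl }

    ⟦⟧-equal? : ∀ i j → Maybe (⟦ i ⟧ ≈ ⟦ j ⟧)
    ⟦⟧-equal? i j with i ℤ.≟ j
    ... | yes ≡.refl = just refl
    ... | no _       = nothing

  open Algebra.Solver.Ring ℤ.+-*-rawRing (fromCommutativeRing R) ℤ-morphism ⟦⟧-equal? public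
    using (solve; _:=_; _:+_; _:*_; :-_; _:-_; con)

module Polynomials {c ℓ} (R : CommutativeRing c ℓ) where
  open CommutativeRing R
  open import Data.Nat using (_∸_; _≤_; _<_)
  open IntegerSolver R
  open import Algebra.Properties.Ring ring using (-0#≈0#)
  open import Algebra.Properties.Semiring.Mult semiring using (×-homo-+; ×1-homo-*) renaming (_×_ to _×ᵤ_)
  open import Relation.Binary.Reasoning.Setoid setoid

  infixl 9 _at_

  _at_ : List Carrier → Carrier → Carrier
  []      at x = 0#
  (a ∷ p) at x = a + x * p at x

  at-cong : ∀ p {x y} → x ≈ y → p at x ≈ p at y
  at-cong []      x≈y = refl
  at-cong (a ∷ p) x≈y = +-congˡ (*-cong x≈y (at-cong p x≈y))

  negate : List Carrier → List Carrier
  negate = map (λ a → - a)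

  negate-at : ∀ p x → negate p at x ≈ - p at x
  negate-at []      x = sym -0#≈0#
  negate-at (a ∷ p) x = trans (+-congˡ (*-congˡ (negate-at p x)))
                          (solve 3 (λ a x P → :- a :+ x :* (:- P) := :- (a :+ x :* P)) refl a x (p at x))

  leading : List Carrier → Carrier
  leading []              = 0#
  leading (a ∷ [])        = a
  leading (_ ∷ p@(_ ∷ _)) = leading p

  deflate : Carrier → List Carrier → List Carrier
  deflate r []              = []
  deflate r (_ ∷ [])        = []
  deflate r (_ ∷ p@(_ ∷ _)) = p at r ∷ deflate r p

  deflate-spec : ∀ r p x → p at x ≈ (x - r) * deflate r p at x + p at r
  deflate-spec r []      x = solve 2 (λ x r → con (+ 0) := (x :- r) :* con (+ 0) :+ con (+ 0)) refl x r
  deflate-spec r (a ∷ []) x = solve 3 (λ a x r → a :+ x :* con (+ 0) := (x :- r) :* con (+ 0) :+ (a :+ r :* con (+ 0))) refl a x r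
  deflate-spec r (a ∷ p@(_ ∷ _)) x = begin
    a + x * p at x                    ≈⟨ +-congˡ (*-congˡ (deflate-spec r p x)) ⟩
    a + x * ((x - r) * q + p at r)    ≈⟨ solve 5 (λ a x r q pr → a :+ x :* ((x :- r) :* q :+ pr) := (x :- r) :* (pr :+ x :* q) :+ (a :+ r :* pr)) refl a x r q (p at r) ⟩
    (x - r) * (p at r + x * q) + (a + r * p at r) ∎
    where q = deflate r p at x

  IsRoot : List Carrier → Carrier → Set ℓ
  IsRoot p r = p at r ≈ 0#

  deflate-root : ∀ p {r} → IsRoot p r → ∀ x → p at x ≈ (x - r) * deflate r p at x
  deflate-root p {r} p[r]≈0 x = trans (deflate-spec r p x) (trans (+-congˡ p[r]≈0) (+-identityʳ _))

  length-deflate : ∀ r p → length (deflate r p) ≡ ℕ.pred (length p)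
  length-deflate r []              = ≡.refl
  length-deflate r (_ ∷ [])        = ≡.refl
  length-deflate r (_ ∷ p@(_ ∷ _)) = ≡.cong suc (length-deflate r p)

  leading-deflate : ∀ r a b p → leading (deflate r (a ∷ b ∷ p)) ≈ leading (b ∷ p)
  leading-deflate r a b []      = trans (+-congˡ (zeroʳ r)) (+-identityʳ b)
  leading-deflate r a b (c ∷ p) = leading-deflate r b c p

  deflateAll : List Carrier → List Carrier → List Carrier
  deflateAll []       p = p
  deflateAll (r ∷ rs) p = deflateAll rs (deflate r p)

  length-deflateAll : ∀ rs p → length (deflateAll rs p) ≡ length p ∸ length rs
  length-deflateAll []       p = ≡.refl
  length-deflateAll (r ∷ rs) p = ≡.trans (length-deflateAll rs (deflate r p))
    (≡.trans (≡.cong (_∸ length rs) (length-deflate r p)) (pred-∸ (length p) (length rs)))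
    where
    pred-∸ : ∀ m n → ℕ.pred m ∸ n ≡ m ∸ suc n
    pred-∸ zero n = ℕ.0∸n≡0 n
    pred-∸ (suc m) n = ≡.refl

  leading-deflateAll : ∀ rs p → length rs < length p → leading (deflateAll rs p) ≈ leading p
  leading-deflateAll []       p           _          = refl
  leading-deflateAll (r ∷ rs) (a ∷ b ∷ p) (s≤s rs<p) =
    trans (leading-deflateAll rs (deflate r (a ∷ b ∷ p)) rs<deflated) (leading-deflate r a b p)
    where
    rs<deflated : length rs < length (deflate r (a ∷ b ∷ p))
    rs<deflated = ≡.subst (length rs <_) (≡.sym (length-deflate r (a ∷ b ∷ p))) rs<p

  ι : ℕ → Carrier
  ι n = n ×ᵤ 1#

  ι-∸ : ∀ {a k} → k ≤ a → ι a - ι k ≈ ι (a ∸ k)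
  ι-∸ {a} {k} k≤a = begin
    ι a - ι k                  ≡⟨ ≡.cong (λ n → ι n - ι k) (ℕ.m+[n∸m]≡n k≤a) ⟨
    ι (k ℕ.+ (a ∸ k)) - ι k    ≈⟨ +-congʳ (×-homo-+ 1# k (a ∸ k)) ⟩
    (ι k + ι (a ∸ k)) - ι k    ≈⟨ solve 2 (λ K D → (K :+ D) :- K := D) refl (ι k) (ι (a ∸ k)) ⟩
    ι (a ∸ k)                  ∎

  poly : (ℕ → ℕ) → ℕ → List Carrier
  poly f n = applyUpTo (λ j → ι (f j)) n

  poly-cong : ∀ {f g} n → (∀ {j} → j < n → f j ≡ g j) → poly f n ≡ poly g n
  poly-cong zero    f≗g = ≡.refl
  poly-cong (suc n) f≗g = ≡.cong₂ _∷_ (≡.cong ι (f≗g (s≤s z≤n))) (poly-cong n (λ j<n → f≗g (s≤s j<n)))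

  poly-+ : ∀ f g n x → poly (λ j → f j ℕ.+ g j) n at x ≈ poly f n at x + poly g n at x
  poly-+ f g zero    x = sym (+-identityʳ 0#)
  poly-+ f g (suc n) x = begin
    ι (f 0 ℕ.+ g 0) + x * poly (λ j → f (suc j) ℕ.+ g (suc j)) n at x
      ≈⟨ +-cong (×-homo-+ 1# (f 0) (g 0)) (*-congˡ (poly-+ (λ j → f (suc j)) (λ j → g (suc j)) n x)) ⟩
    (ι (f 0) + ι (g 0)) + x * (F + G)
      ≈⟨ solve 5 (λ a b x F G → (a :+ b) :+ x :* (F :+ G) := (a :+ x :* F) :+ (b :+ x :* G)) refl (ι (f 0)) (ι (g 0)) x F G ⟩
    (ι (f 0) + x * F) + (ι (g 0) + x * G) ∎
    where
    F = poly (λ j → f (suc j)) n at x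
    G = poly (λ j → g (suc j)) n at x

  poly-shift : ∀ f n x → poly (shift f) (suc n) at x ≈ x * poly f n at x
  poly-shift f n x = +-identityˡ _

  poly-extend : ∀ f n x → f n ≡ 0 → poly f (suc n) at x ≈ poly f n at x
  poly-extend f zero    x fn≡0 = trans (+-cong (reflexive (≡.cong ι fn≡0)) (zeroʳ x)) (+-identityʳ 0#)
  poly-extend f (suc n) x fn≡0 = +-congˡ (*-congˡ (poly-extend (λ j → f (suc j)) n x fn≡0))

  poly-zeros : ∀ f n x → (∀ j → f j ≡ 0) → poly f n at x ≈ 0#
  poly-zeros f zero    x f≗0 = refl
  poly-zeros f (suc n) x f≗0 = begin
    ι (f 0) + x * poly (λ j → f (suc j)) n at x  ≈⟨ +-cong (reflexive (≡.cong ι (f≗0 0))) (*-congˡ (poly-zeros (λ j → f (suc j)) n x (λ j → f≗0 (suc j)))) ⟩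
    0# + x * 0#                                 ≈⟨ trans (+-identityˡ _) (zeroʳ x) ⟩
    0# ∎

  leading-poly : ∀ f n → leading (poly f (suc n)) ≡ ι (f n)
  leading-poly f zero    = ≡.refl
  leading-poly f (suc n) = leading-poly (λ j → f (suc j)) n

module UniformPolynomials {c ℓ} (R : CommutativeRing c ℓ) where
  open CommutativeRing R
  open IntegerSolver R
  open Polynomials R
  open import Algebra.Properties.Semiring.Mult semiring using (×-homo-+; ×1-homo-*)
  open import Relation.Binary.Reasoning.Setoid setoid

  E : ℕ → ℕ → ℕ → List Carrier
  E a b k = poly (coeffE a b k) (suc k)

  E′ : ℕ → ℕ → ℕ → Carrier → Carrier
  E′ a b zero    z = 0#
  E′ a b (suc k) z = E a b k at z

  E-pascal : ∀ a b k z → E a (suc b) (suc k) at z ≈ E a b (suc k) at z + (1# + z) * E a b k at z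
  E-pascal a b k z = begin
    E a (suc b) (suc k) at z
      ≡⟨ ≡.cong (_at z) (poly-cong (suc (suc k)) (λ {j} _ → coeffE-pascal a b k j)) ⟩
    poly (λ j → e₁ j ℕ.+ (e₀ j ℕ.+ shift e₀ j)) (suc (suc k)) at z
      ≈⟨ poly-+ e₁ (λ j → e₀ j ℕ.+ shift e₀ j) (suc (suc k)) z ⟩
    E a b (suc k) at z + poly (λ j → e₀ j ℕ.+ shift e₀ j) (suc (suc k)) at z
      ≈⟨ +-congˡ (poly-+ e₀ (shift e₀) (suc (suc k)) z) ⟩
    E a b (suc k) at z + (poly e₀ (suc (suc k)) at z + poly (shift e₀) (suc (suc k)) at z)
      ≈⟨ +-congˡ (+-cong (poly-extend e₀ (suc k) z e₀-vanishes) (poly-shift e₀ (suc k) z)) ⟩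
    E a b (suc k) at z + (E a b k at z + z * E a b k at z)
      ≈⟨ +-congˡ (solve 2 (λ e z → e :+ z :* e := (con (+ 1) :+ z) :* e) refl (E a b k at z) z) ⟩
    E a b (suc k) at z + (1# + z) * E a b k at z ∎
    where
    e₁ = coeffE a b (suc k)
    e₀ = coeffE a b k
    e₀-vanishes : e₀ (suc k) ≡ 0
    e₀-vanishes = ≡.trans (≡.cong ((b C suc k) ℕ.*_) (C[k⊖1+k]≡0 _ k)) (ℕ.*-zeroʳ (b C suc k))

  E′-pascal : ∀ a b k z → E a (suc b) k at z ≈ E a b k at z + (1# + z) * E′ a b k z
  E′-pascal a b zero    z = sym (trans (+-congˡ (zeroʳ _)) (+-identityʳ _))
  E′-pascal a b (suc k) z = E-pascal a b k z

  E-b≡0 : ∀ a k z → E a 0 k at z ≈ ι (a C k)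
  E-b≡0 a k z = begin
    ι ((a C k) ℕ.+ 0) + z * poly (λ _ → 0) k at z  ≈⟨ +-cong (reflexive (≡.cong ι (ℕ.+-identityʳ (a C k)))) (*-congˡ (poly-zeros (λ _ → 0) k z (λ _ → ≡.refl))) ⟩
    ι (a C k) + z * 0#                              ≈⟨ trans (+-congˡ (zeroʳ z)) (+-identityʳ _) ⟩
    ι (a C k) ∎

  E-at-−1 : ∀ a b k → E a b k at (- 1#) ≈ ι (a C k)
  E-at-−1 a zero    k = E-b≡0 a k (- 1#)
  E-at-−1 a (suc b) k = begin
    E a (suc b) k at (- 1#)                              ≈⟨ E′-pascal a b k (- 1#) ⟩
    E a b k at (- 1#) + (1# + - 1#) * E′ a b k (- 1#)    ≈⟨ +-congˡ (trans (*-congʳ (-‿inverseʳ 1#)) (zeroˡ _)) ⟩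
    E a b k at (- 1#) + 0#                               ≈⟨ +-identityʳ _ ⟩
    E a b k at (- 1#)                                    ≈⟨ E-at-−1 a b k ⟩
    ι (a C k) ∎

  ι-absorption : ∀ a k → ι (suc k) * ι (a C suc k) ≈ (ι a - ι k) * ι (a C k)
  ι-absorption a k = begin
    S * C₁                      ≈⟨ solve 2 (λ X Y → X := (X :+ Y) :- Y) refl (S * C₁) (K * C₀) ⟩
    (S * C₁ + K * C₀) - K * C₀  ≈⟨ +-congʳ ℕ-identity ⟩
    A * C₀ - K * C₀             ≈⟨ solve 3 (λ A K C → A :* C :- K :* C := (A :- K) :* C) refl A K C₀ ⟩
    (A - K) * C₀                ∎
    where
    A = ι a
    K = ι k
    S = ι (suc k)
    C₀ = ι (a C k)
    C₁ = ι (a C suc k)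
    ℕ-identity : S * C₁ + K * C₀ ≈ A * C₀
    ℕ-identity = begin
      S * C₁ + K * C₀                                    ≈⟨ +-cong (×1-homo-* (suc k) (a C suc k)) (×1-homo-* k (a C k)) ⟨
      ι (suc k ℕ.* (a C suc k)) + ι (k ℕ.* (a C k))      ≈⟨ ×-homo-+ 1# (suc k ℕ.* (a C suc k)) (k ℕ.* (a C k)) ⟨
      ι (suc k ℕ.* (a C suc k) ℕ.+ k ℕ.* (a C k))        ≡⟨ ≡.cong ι ([1+k]*nC[1+k]+k*nCk≡n*nCk a k) ⟩
      ι (a ℕ.* (a C k))                                  ≈⟨ ×1-homo-* a (a C k) ⟩
      A * C₀                                             ∎

  Recurrence : ℕ → ℕ → ℕ → Carrier → Set ℓ
  Recurrence a b k z =
    ι (suc k) * E a b (suc k) at z ≈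
      ((ι a - ι k) + (ι b - ι k) * (1# + z)) * E a b k at z + (((ι a + ι b) + 1#) - ι k) * ((1# + z) * E′ a b k z)

  recurrence-b≡0 : ∀ a k z → Recurrence a 0 k z
  recurrence-b≡0 a zero z = trans lhs (sym rhs)
    where
    A = ι a
    w = 1# + z
    C₀ = ι (a C 0)
    lhs : ι 1 * E a 0 1 at z ≈ (A - 0#) * C₀
    lhs = trans (*-congˡ (E-b≡0 a 1 z)) (ι-absorption a 0)
    rhs : ((A - 0#) + (0# - 0#) * w) * E a 0 0 at z + (((A + 0#) + 1#) - 0#) * (w * 0#) ≈ (A - 0#) * C₀
    rhs = trans (+-congʳ (*-congˡ (E-b≡0 a 0 z)))
            (solve 3 (λ A w C₀ → ((A :- con (+ 0)) :+ (con (+ 0) :- con (+ 0)) :* w) :* C₀ :+ (((A :+ con (+ 0)) :+ con (+ 1)) :- con (+ 0)) :* (w :* con (+ 0))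
                                 := (A :- con (+ 0)) :* C₀) refl A w C₀)
  recurrence-b≡0 a (suc k) z = trans lhs (sym rhs)
    where
    A = ι a
    w = 1# + z
    K′ = ι k
    K = ι (suc k)
    C₀ = ι (a C k)
    C₁ = ι (a C suc k)
    lhs : ι (suc (suc k)) * E a 0 (suc (suc k)) at z ≈ (A - K) * C₁
    lhs = trans (*-congˡ (E-b≡0 a (suc (suc k)) z)) (ι-absorption a (suc k))
    rhs : ((A - K) + (0# - K) * w) * E a 0 (suc k) at z + (((A + 0#) + 1#) - K) * (w * E a 0 k at z) ≈ (A - K) * C₁
    rhs = begin
      ((A - K) + (0# - K) * w) * E a 0 (suc k) at z + (((A + 0#) + 1#) - K) * (w * E a 0 k at z)
        ≈⟨ +-cong (*-congˡ (E-b≡0 a (suc k) z)) (*-congˡ (*-congˡ (E-b≡0 a k z))) ⟩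
      ((A - K) + (0# - K) * w) * C₁ + (((A + 0#) + 1#) - K) * (w * C₀)
        ≈⟨ solve 5 (λ A K′ w C₁ C₀ →
             ((A :- (con (+ 1) :+ K′)) :+ (con (+ 0) :- (con (+ 1) :+ K′)) :* w) :* C₁ :+ (((A :+ con (+ 0)) :+ con (+ 1)) :- (con (+ 1) :+ K′)) :* (w :* C₀)
             := (A :- (con (+ 1) :+ K′)) :* C₁ :- w :* ((con (+ 1) :+ K′) :* C₁) :+ w :* ((A :- K′) :* C₀)) refl A K′ w C₁ C₀ ⟩
      (A - K) * C₁ - w * (K * C₁) + w * ((A - K′) * C₀)
        ≈⟨ +-congʳ (+-congˡ (-‿cong (*-congˡ (ι-absorption a k)))) ⟩
      (A - K) * C₁ - w * ((A - K′) * C₀) + w * ((A - K′) * C₀)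
        ≈⟨ solve 2 (λ X Y → X :- Y :+ Y := X) refl ((A - K) * C₁) (w * ((A - K′) * C₀)) ⟩
      (A - K) * C₁ ∎

  recurrence-step₀ : ∀ a b z → Recurrence a b 0 z → Recurrence a (suc b) 0 z
  recurrence-step₀ a b z rec₀ = trans lhs (sym rhs)
    where
    A = ι a
    B = ι b
    w = 1# + z
    E₁ = E a b 1 at z
    E₀ = E a b 0 at z
    R₀ = ((A - 0#) + (B - 0#) * w) * E₀ + (((A + B) + 1#) - 0#) * (w * 0#)
    lhs : ι 1 * E a (suc b) 1 at z ≈ R₀ + w * E₀
    lhs = begin
      ι 1 * E a (suc b) 1 at z   ≈⟨ *-congˡ (E-pascal a b 0 z) ⟩
      ι 1 * (E₁ + w * E₀)        ≈⟨ solve 3 (λ E₁ w E₀ → (con (+ 1) :+ con (+ 0)) :* (E₁ :+ w :* E₀) := (con (+ 1) :+ con (+ 0)) :* E₁ :+ w :* E₀) refl E₁ w E₀ ⟩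
      ι 1 * E₁ + w * E₀          ≈⟨ +-congʳ rec₀ ⟩
      R₀ + w * E₀                ∎
    rhs : ((A - 0#) + (ι (suc b) - 0#) * w) * E a (suc b) 0 at z + (((A + ι (suc b)) + 1#) - 0#) * (w * 0#) ≈ R₀ + w * E₀
    rhs = solve 4 (λ A B w E₀ →
            ((A :- con (+ 0)) :+ ((con (+ 1) :+ B) :- con (+ 0)) :* w) :* E₀ :+ (((A :+ (con (+ 1) :+ B)) :+ con (+ 1)) :- con (+ 0)) :* (w :* con (+ 0))
            := ((A :- con (+ 0)) :+ (B :- con (+ 0)) :* w) :* E₀ :+ (((A :+ B) :+ con (+ 1)) :- con (+ 0)) :* (w :* con (+ 0)) :+ w :* E₀) refl A B w E₀

  -- Both sides are expanded by Pascal's rule into level-b values, where the recurrences at k + 1 and k apply.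
  recurrence-step : ∀ a b k z → Recurrence a b (suc k) z → Recurrence a b k z → Recurrence a (suc b) (suc k) z
  recurrence-step a b k z rec₁ rec₀ = trans lhs (sym rhs)
    where
    A = ι a
    B = ι b
    K′ = ι k
    K = ι (suc k)
    w = 1# + z
    E₂ = E a b (suc (suc k)) at z
    E₁ = E a b (suc k) at z
    E₀ = E a b k at z
    E₋ = E′ a b k z
    R₁ = ((A - K) + (B - K) * w) * E₁ + (((A + B) + 1#) - K) * (w * E₀)
    R₂ = ((A - K′) + (B - K′) * w) * E₀ + (((A + B) + 1#) - K′) * (w * E₋)
    lhs : ι (suc (suc k)) * E a (suc b) (suc (suc k)) at z ≈ R₁ + w * E₁ + w * R₂
    lhs = begin
      ι (suc (suc k)) * E a (suc b) (suc (suc k)) at z  ≈⟨ *-congˡ (E-pascal a b (suc k) z) ⟩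
      ι (suc (suc k)) * (E₂ + w * E₁)                   ≈⟨ solve 4 (λ K′ E₂ w E₁ →
                                                             (con (+ 1) :+ (con (+ 1) :+ K′)) :* (E₂ :+ w :* E₁)
                                                             := (con (+ 1) :+ (con (+ 1) :+ K′)) :* E₂ :+ w :* E₁ :+ w :* ((con (+ 1) :+ K′) :* E₁)) refl K′ E₂ w E₁ ⟩
      ι (suc (suc k)) * E₂ + w * E₁ + w * (K * E₁)      ≈⟨ +-cong (+-congʳ rec₁) (*-congˡ rec₀) ⟩
      R₁ + w * E₁ + w * R₂                              ∎
    rhs : ((A - K) + (ι (suc b) - K) * w) * E a (suc b) (suc k) at z + (((A + ι (suc b)) + 1#) - K) * (w * E a (suc b) k at z)
          ≈ R₁ + w * E₁ + w * R₂
    rhs = begin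
      ((A - K) + (ι (suc b) - K) * w) * E a (suc b) (suc k) at z + (((A + ι (suc b)) + 1#) - K) * (w * E a (suc b) k at z)
        ≈⟨ +-cong (*-congˡ (E-pascal a b k z)) (*-congˡ (*-congˡ (E′-pascal a b k z))) ⟩
      ((A - K) + (ι (suc b) - K) * w) * (E₁ + w * E₀) + (((A + ι (suc b)) + 1#) - K) * (w * (E₀ + w * E₋))
        ≈⟨ solve 7 (λ A B K′ w E₁ E₀ E₋ →
             ((A :- (con (+ 1) :+ K′)) :+ ((con (+ 1) :+ B) :- (con (+ 1) :+ K′)) :* w) :* (E₁ :+ w :* E₀)
               :+ (((A :+ (con (+ 1) :+ B)) :+ con (+ 1)) :- (con (+ 1) :+ K′)) :* (w :* (E₀ :+ w :* E₋))
             := ((A :- (con (+ 1) :+ K′)) :+ (B :- (con (+ 1) :+ K′)) :* w) :* E₁ :+ (((A :+ B) :+ con (+ 1)) :- (con (+ 1) :+ K′)) :* (w :* E₀)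
                :+ w :* E₁
                :+ w :* (((A :- K′) :+ (B :- K′) :* w) :* E₀ :+ (((A :+ B) :+ con (+ 1)) :- K′) :* (w :* E₋)))
             refl A B K′ w E₁ E₀ E₋ ⟩
      R₁ + w * E₁ + w * R₂ ∎

  E-recurrence : ∀ a b k z → Recurrence a b k z
  E-recurrence a zero    k       z = recurrence-b≡0 a k z
  E-recurrence a (suc b) zero    z = recurrence-step₀ a b z (E-recurrence a b 0 z)
  E-recurrence a (suc b) (suc k) z = recurrence-step a b k z (E-recurrence a b (suc k) z) (E-recurrence a b k z)

module OrderedField {c ℓ₁ ℓ₂} (R : RealField c ℓ₁ ℓ₂) where
  open RealField R hiding (_≤_; +-mono-≤)
  open IntegerSolver commRing
  open IsTotalOrder isTotalOrder public using (total; antisym) renaming (reflexive to ≤-reflexive; trans to ≤-trans)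
  open import Algebra.Properties.Ring ring using (-‿involutive; -0#≈0#; -‿distribˡ-*; -‿distribʳ-*)

  -- Defs declares no fixity for _≤_.
  infix 4 _≤_ _<_

  _≤_ : Carrier → Carrier → Set ℓ₂
  _≤_ = RealField._≤_ R

  _<_ : Carrier → Carrier → Set ℓ₂
  x < y = ¬ (y ≤ x)

  ≤-refl : ∀ {x} → x ≤ x
  ≤-refl = ≤-reflexive refl

  ≤-respˡ-≈ : ∀ {x y z} → x ≈ y → x ≤ z → y ≤ z
  ≤-respˡ-≈ x≈y x≤z = ≤-trans (≤-reflexive (sym x≈y)) x≤z

  ≤-respʳ-≈ : ∀ {x y z} → y ≈ z → x ≤ y → x ≤ z
  ≤-respʳ-≈ y≈z x≤y = ≤-trans x≤y (≤-reflexive y≈z)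

  <⇒≤ : ∀ {x y} → x < y → x ≤ y
  <⇒≤ {x} {y} x<y with total x y
  ... | inj₁ x≤y = x≤y
  ... | inj₂ y≤x = ⊥-elim (x<y y≤x)

  <⇒≉ : ∀ {x y} → x < y → ¬ (x ≈ y)
  <⇒≉ x<y x≈y = x<y (≤-reflexive (sym x≈y))

  ≤-<-trans : ∀ {x y z} → x ≤ y → y < z → x < z
  ≤-<-trans x≤y y<z z≤x = y<z (≤-trans z≤x x≤y)

  <-trans : ∀ {x y z} → x < y → y < z → x < z
  <-trans x<y = ≤-<-trans (<⇒≤ x<y)

  <-respˡ-≈ : ∀ {x y z} → x ≈ y → x < z → y < z
  <-respˡ-≈ x≈y x<z z≤y = x<z (≤-respʳ-≈ (sym x≈y) z≤y)

  <-respʳ-≈ : ∀ {x y z} → y ≈ z → x < y → x < z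
  <-respʳ-≈ y≈z x<y z≤x = x<y (≤-respˡ-≈ (sym y≈z) z≤x)

  +-monoˡ-≤ : ∀ {x y} z → x ≤ y → x + z ≤ y + z
  +-monoˡ-≤ = RealField.+-mono-≤ R

  +-monoʳ-≤ : ∀ {x y} z → x ≤ y → z + x ≤ z + y
  +-monoʳ-≤ z x≤y = ≤-respˡ-≈ (+-comm _ z) (≤-respʳ-≈ (+-comm _ z) (+-monoˡ-≤ z x≤y))

  +-mono-≤ : ∀ {x y u v} → x ≤ y → u ≤ v → x + u ≤ y + v
  +-mono-≤ x≤y u≤v = ≤-trans (+-monoˡ-≤ _ x≤y) (+-monoʳ-≤ _ u≤v)

  x≤y⇒0≤y-x : ∀ {x y} → x ≤ y → 0# ≤ y - x
  x≤y⇒0≤y-x {x} x≤y = ≤-respˡ-≈ (-‿inverseʳ x) (+-monoˡ-≤ (- x) x≤y)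

  0≤y-x⇒x≤y : ∀ {x y} → 0# ≤ y - x → x ≤ y
  0≤y-x⇒x≤y {x} {y} 0≤y-x =
    ≤-respˡ-≈ (+-identityˡ x) (≤-respʳ-≈ (solve 2 (λ x y → (y :- x) :+ x := y) refl x y) (+-monoˡ-≤ x 0≤y-x))

  neg-antimono-≤ : ∀ {x y} → x ≤ y → - y ≤ - x
  neg-antimono-≤ {x} {y} x≤y = 0≤y-x⇒x≤y (≤-respʳ-≈ (solve 2 (λ x y → y :- x := (:- x) :- (:- y)) refl x y) (x≤y⇒0≤y-x x≤y))

  x≤0⇒0≤-x : ∀ {x} → x ≤ 0# → 0# ≤ - x
  x≤0⇒0≤-x x≤0 = ≤-respˡ-≈ -0#≈0# (neg-antimono-≤ x≤0)

  0≤x⇒-x≤0 : ∀ {x} → 0# ≤ x → - x ≤ 0#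
  0≤x⇒-x≤0 0≤x = ≤-respʳ-≈ -0#≈0# (neg-antimono-≤ 0≤x)

  x<0⇒0<-x : ∀ {x} → x < 0# → 0# < - x
  x<0⇒0<-x {x} x<0 -x≤0 = x<0 (≤-respʳ-≈ (-‿involutive x) (x≤0⇒0≤-x -x≤0))

  0<-x⇒x<0 : ∀ {x} → 0# < - x → x < 0#
  0<-x⇒x<0 0<-x 0≤x = 0<-x (0≤x⇒-x≤0 0≤x)

  x<y⇒0<y-x : ∀ {x y} → x < y → 0# < y - x
  x<y⇒0<y-x x<y y-x≤0 = x<y (≤-respʳ-≈ (+-identityˡ _) (≤-respˡ-≈ (solve 2 (λ x y → (y :- x) :+ x := y) refl _ _) (+-monoˡ-≤ _ y-x≤0)))

  x<y⇒x-y<0 : ∀ {x y} → x < y → x - y < 0#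
  x<y⇒x-y<0 {x} {y} x<y 0≤x-y = x<y (0≤y-x⇒x≤y 0≤x-y)

  0<y-x⇒x<y : ∀ {x y} → 0# < y - x → x < y
  0<y-x⇒x<y {x} 0<y-x y≤x = 0<y-x (≤-respʳ-≈ (-‿inverseʳ x) (+-monoˡ-≤ (- x) y≤x))

  *-monoˡ-≤-nonNeg : ∀ {x y} z → 0# ≤ z → x ≤ y → z * x ≤ z * y
  *-monoˡ-≤-nonNeg {x} {y} z 0≤z x≤y = 0≤y-x⇒x≤y
    (≤-respʳ-≈ (solve 3 (λ x y z → z :* (y :- x) := z :* y :- z :* x) refl x y z) (*-nonneg 0≤z (x≤y⇒0≤y-x x≤y)))

  *-monoʳ-≤-nonNeg : ∀ {x y} z → 0# ≤ z → x ≤ y → x * z ≤ y * z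
  *-monoʳ-≤-nonNeg z 0≤z x≤y = ≤-respˡ-≈ (*-comm z _) (≤-respʳ-≈ (*-comm z _) (*-monoˡ-≤-nonNeg z 0≤z x≤y))

  x≉0∧xy≈0⇒y≈0 : ∀ {x y} → ¬ (x ≈ 0#) → x * y ≈ 0# → y ≈ 0#
  x≉0∧xy≈0⇒y≈0 {x} {y} x≉0 xy≈0 with inverse x x≉0
  ... | x⁻¹ , xx⁻¹≈1 = begin
    y               ≈⟨ solve 3 (λ x x⁻¹ y → y := (x :* x⁻¹) :* y :+ y :* (con (+ 1) :- x :* x⁻¹)) refl x x⁻¹ y ⟩
    (x * x⁻¹) * y + y * (1# - x * x⁻¹)  ≈⟨ +-cong (solve 3 (λ x x⁻¹ y → (x :* x⁻¹) :* y := x⁻¹ :* (x :* y)) refl x x⁻¹ y) (*-congˡ (+-congˡ (-‿cong xx⁻¹≈1))) ⟩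
    x⁻¹ * (x * y) + y * (1# - 1#)       ≈⟨ +-cong (*-congˡ xy≈0) (*-congˡ (-‿inverseʳ 1#)) ⟩
    x⁻¹ * 0# + y * 0#                   ≈⟨ solve 2 (λ a b → a :* con (+ 0) :+ b :* con (+ 0) := con (+ 0)) refl x⁻¹ y ⟩
    0#                                  ∎
    where open import Relation.Binary.Reasoning.Setoid setoid

  0≤1 : 0# ≤ 1#
  0≤1 with total 0# 1#
  ... | inj₁ 0≤1 = 0≤1
  ... | inj₂ 1≤0 = ≤-respʳ-≈ (solve 0 (:- con (+ 1) :* :- con (+ 1) := con (+ 1)) refl) (*-nonneg (x≤0⇒0≤-x 1≤0) (x≤0⇒0≤-x 1≤0))

  0<1 : 0# < 1#
  0<1 1≤0 = 0≉1 (antisym 0≤1 1≤0)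

  *-pos-pos : ∀ {x y} → 0# < x → 0# < y → 0# < x * y
  *-pos-pos 0<x 0<y xy≤0 = <⇒≉ 0<y (sym (x≉0∧xy≈0⇒y≈0 (λ x≈0 → <⇒≉ 0<x (sym x≈0)) (antisym xy≤0 (*-nonneg (<⇒≤ 0<x) (<⇒≤ 0<y)))))

  *-neg-pos : ∀ {x y} → x < 0# → 0# < y → x * y < 0#
  *-neg-pos x<0 0<y = 0<-x⇒x<0 (<-respʳ-≈ (sym (-‿distribˡ-* _ _)) (*-pos-pos (x<0⇒0<-x x<0) 0<y))

  *-pos-neg : ∀ {x y} → 0# < x → y < 0# → x * y < 0#
  *-pos-neg 0<x y<0 = 0<-x⇒x<0 (<-respʳ-≈ (sym (-‿distribʳ-* _ _)) (*-pos-pos 0<x (x<0⇒0<-x y<0)))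

  *-neg-neg : ∀ {x y} → x < 0# → y < 0# → 0# < x * y
  *-neg-neg x<0 y<0 = <-respʳ-≈ (solve 2 (λ x y → (:- x) :* (:- y) := x :* y) refl _ _) (*-pos-pos (x<0⇒0<-x x<0) (x<0⇒0<-x y<0))

  +-nonNeg : ∀ {x y} → 0# ≤ x → 0# ≤ y → 0# ≤ x + y
  +-nonNeg 0≤x 0≤y = ≤-respˡ-≈ (+-identityʳ 0#) (+-mono-≤ 0≤x 0≤y)

  +-pos-nonNeg : ∀ {x y} → 0# < x → 0# ≤ y → 0# < x + y
  +-pos-nonNeg {x} 0<x 0≤y x+y≤0 = 0<x (≤-trans (≤-respˡ-≈ (+-identityʳ x) (+-monoʳ-≤ x 0≤y)) x+y≤0)

  HasSign : ℕ → Carrier → Set ℓ₂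
  HasSign zero          y = 0# < y
  HasSign (suc zero)    y = y < 0#
  HasSign (suc (suc n)) y = HasSign n y

  HasSign-resp : ∀ n {x y} → x ≈ y → HasSign n x → HasSign n y
  HasSign-resp zero          x≈y = <-respʳ-≈ x≈y
  HasSign-resp (suc zero)    x≈y = <-respˡ-≈ x≈y
  HasSign-resp (suc (suc n)) x≈y = HasSign-resp n x≈y

  HasSign-*pos : ∀ n {c y} → 0# < c → HasSign n y → HasSign n (c * y)
  HasSign-*pos zero          0<c = *-pos-pos 0<c
  HasSign-*pos (suc zero)    0<c = *-pos-neg 0<c
  HasSign-*pos (suc (suc n)) 0<c = HasSign-*pos n 0<c

  HasSign-*neg : ∀ n {c y} → c < 0# → HasSign n y → HasSign (suc n) (c * y)
  HasSign-*neg zero          c<0 = *-neg-pos c<0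
  HasSign-*neg (suc zero)    c<0 = *-neg-neg c<0
  HasSign-*neg (suc (suc n)) c<0 = HasSign-*neg n c<0

  HasSign-*pos⁻¹ : ∀ n {c y} → 0# < c → HasSign n (c * y) → HasSign n y
  HasSign-*pos⁻¹ zero          {c} 0<c 0<cy y≤0 = 0<cy (≤-respʳ-≈ (zeroʳ c) (*-monoˡ-≤-nonNeg c (<⇒≤ 0<c) y≤0))
  HasSign-*pos⁻¹ (suc zero)    {c} 0<c cy<0 0≤y = cy<0 (≤-respˡ-≈ (zeroʳ c) (*-monoˡ-≤-nonNeg c (<⇒≤ 0<c) 0≤y))
  HasSign-*pos⁻¹ (suc (suc n))     0<c        = HasSign-*pos⁻¹ n 0<c

  HasSign-same⇒pos : ∀ n {x y} → HasSign n (x * y) → HasSign n y → 0# < x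
  HasSign-same⇒pos zero       {x} {y} 0<xy 0<y x≤0 = 0<xy (≤-respʳ-≈ (zeroˡ y) (*-monoʳ-≤-nonNeg y (<⇒≤ 0<y) x≤0))
  HasSign-same⇒pos (suc zero) {x} {y} xy<0 y<0 x≤0 =
    xy<0 (≤-respʳ-≈ (solve 2 (λ x y → (:- x) :* (:- y) := x :* y) refl x y) (*-nonneg (x≤0⇒0≤-x x≤0) (x≤0⇒0≤-x (<⇒≤ y<0))))
  HasSign-same⇒pos (suc (suc n)) = HasSign-same⇒pos n

  HasSign-opposite : ∀ n {x y} → HasSign (suc n) x → HasSign n y → (x < 0# × 0# < y) ⊎ (0# < x × y < 0#)
  HasSign-opposite zero          x<0 0<y = inj₁ (x<0 , 0<y)
  HasSign-opposite (suc zero)    0<x y<0 = inj₂ (0<x , y<0)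
  HasSign-opposite (suc (suc n))         = HasSign-opposite n

module Completeness {c ℓ₁ ℓ₂} (R : RealField c ℓ₁ ℓ₂) where
  open RealField R hiding (_≤_; +-mono-≤)
  open OrderedField R
  open IntegerSolver commRing
  open Polynomials commRing using (_at_; at-cong; negate; negate-at; deflate; deflate-spec)
  open import Algebra.Properties.Ring ring using (-‿involutive; -0#≈0#)
  open import Relation.Binary.Reasoning.Setoid setoid

  two : Carrier
  two = 1# + 1#

  0<two : 0# < two
  0<two = +-pos-nonNeg 0<1 0≤1

  half : Carrier
  half = proj₁ (inverse two (λ two≈0 → <⇒≉ 0<two (sym two≈0)))

  two*half≈1 : two * half ≈ 1#
  two*half≈1 = proj₂ (inverse two (λ two≈0 → <⇒≉ 0<two (sym two≈0)))

  half*[two*x]≈x : ∀ x → half * (two * x) ≈ x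
  half*[two*x]≈x x = begin
    half * (two * x)   ≈⟨ solve 3 (λ h t x → h :* (t :* x) := (t :* h) :* x) refl half two x ⟩
    (two * half) * x   ≈⟨ *-congʳ two*half≈1 ⟩
    1# * x             ≈⟨ *-identityˡ x ⟩
    x                  ∎

  0≤half : 0# ≤ half
  0≤half = <⇒≤ (HasSign-same⇒pos 0 (<-respʳ-≈ (sym (trans (*-comm half two) two*half≈1)) 0<1) 0<two)

  0≤two*x⇒0≤x : ∀ {x} → 0# ≤ two * x → 0# ≤ x
  0≤two*x⇒0≤x {x} 0≤2x = ≤-respʳ-≈ (half*[two*x]≈x x) (≤-respˡ-≈ (zeroʳ half) (*-monoˡ-≤-nonNeg half 0≤half 0≤2x))

  Supremum : (Carrier → Set (c ⊔ ℓ₁ ⊔ ℓ₂)) → Set (c ⊔ ℓ₁ ⊔ ℓ₂)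
  Supremum P = ∃ λ s → (∀ x → P x → x ≤ s) × (∀ b → (∀ x → P x → x ≤ b) → s ≤ b)

  doubled : ℕ → Carrier → Carrier
  doubled zero    y = y
  doubled (suc k) y = two * doubled k y

  -- The supremum s of {2ᵏ y} satisfies s ≤ s / 2.
  ≤-halvings⇒≤0 : ∀ {y} (w : ℕ → Carrier) → (∀ k → two * w (suc k) ≈ w k) → (∀ k → y ≤ w k) → y ≤ 0#
  ≤-halvings⇒≤0 {y} w halving y≤w = ≤-trans (isUpper 0) s≤0
    where
    doubled≤w₀ : ∀ (w : ℕ → Carrier) → (∀ k → two * w (suc k) ≈ w k) → ∀ k → y ≤ w k → doubled k y ≤ w 0
    doubled≤w₀ w halving zero    y≤w₀ = y≤w₀
    doubled≤w₀ w halving (suc k) y≤wₖ₊₁ =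
      ≤-respʳ-≈ (halving 0) (*-monoˡ-≤-nonNeg two (<⇒≤ 0<two) (doubled≤w₀ (λ k → w (suc k)) (λ k → halving (suc k)) k y≤wₖ₊₁))
    Doublings : Carrier → Set (c ⊔ ℓ₁ ⊔ ℓ₂)
    Doublings x = Lift (c ⊔ ℓ₂) (∃ λ k → x ≈ doubled k y)
    supremum : Supremum Doublings
    supremum = lub Doublings (y , lift (0 , refl))
                   (w 0 , λ { x (lift (k , x≈)) → ≤-respˡ-≈ (sym x≈) (doubled≤w₀ w halving k (y≤w k)) })
    s = proj₁ supremum
    isUpper : ∀ k → doubled k y ≤ s
    isUpper k = proj₁ (proj₂ supremum) (doubled k y) (lift (k , refl))
    s≤half*s : s ≤ half * s
    s≤half*s = proj₂ (proj₂ supremum) (half * s) λ { x (lift (k , x≈)) →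
      ≤-respˡ-≈ (trans (half*[two*x]≈x (doubled k y)) (sym x≈)) (*-monoˡ-≤-nonNeg half 0≤half (isUpper (suc k))) }
    s≤0 : s ≤ 0#
    s≤0 = ≤-trans s≤half*s (≤-respʳ-≈ (-‿inverseʳ (half * s)) (≤-respˡ-≈ s-half*s≈half*s (+-monoˡ-≤ (- (half * s)) s≤half*s)))
      where
      s-half*s≈half*s : s - half * s ≈ half * s
      s-half*s≈half*s = begin
        s - half * s                 ≈⟨ +-congʳ (half*[two*x]≈x s) ⟨
        half * (two * s) - half * s  ≈⟨ solve 2 (λ h s → h :* ((con (+ 1) :+ con (+ 1)) :* s) :- h :* s := h :* s) refl half s ⟩
        half * s                     ∎

  infix 4 ∣_∣≤_
  ∣_∣≤_ : Carrier → Carrier → Set ℓ₂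
  ∣ x ∣≤ M = x ≤ M × - x ≤ M

  ∣x∣≤-exists : ∀ x → ∃ λ M → ∣ x ∣≤ M
  ∣x∣≤-exists x with total 0# x
  ... | inj₁ 0≤x = x , ≤-refl , ≤-trans (0≤x⇒-x≤0 0≤x) 0≤x
  ... | inj₂ x≤0 = - x , ≤-trans x≤0 (x≤0⇒0≤-x x≤0) , ≤-refl

  ∣x∣≤M⇒0≤M : ∀ {x M} → ∣ x ∣≤ M → 0# ≤ M
  ∣x∣≤M⇒0≤M {x} {M} (x≤M , -x≤M) = 0≤two*x⇒0≤x (≤-respˡ-≈ (-‿inverseʳ x) (≤-respʳ-≈ M+M≈two*M (+-mono-≤ x≤M -x≤M)))
    where
    M+M≈two*M : M + M ≈ two * M
    M+M≈two*M = solve 1 (λ M → M :+ M := (con (+ 1) :+ con (+ 1)) :* M) refl M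

  ∣x∣≤-+ : ∀ {s t A B} → ∣ s ∣≤ A → ∣ t ∣≤ B → ∣ s + t ∣≤ A + B
  ∣x∣≤-+ {s} {t} (s≤A , -s≤A) (t≤B , -t≤B) =
    +-mono-≤ s≤A t≤B , ≤-respˡ-≈ (solve 2 (λ s t → :- s :+ :- t := :- (s :+ t)) refl s t) (+-mono-≤ -s≤A -t≤B)

  -- (A − s)(B + t) + (A + s)(B − t) = 2 (AB − st), and symmetrically for AB + st.
  ∣x∣≤-* : ∀ {s t A B} → ∣ s ∣≤ A → ∣ t ∣≤ B → ∣ s * t ∣≤ A * B
  ∣x∣≤-* {s} {t} {A} {B} (s≤A , -s≤A) (t≤B , -t≤B) = upper , lower
    where
    0≤A-s : 0# ≤ A - s
    0≤A-s = x≤y⇒0≤y-x s≤A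
    0≤B-t : 0# ≤ B - t
    0≤B-t = x≤y⇒0≤y-x t≤B
    0≤A+s : 0# ≤ A + s
    0≤A+s = ≤-respʳ-≈ (+-congˡ (-‿involutive s)) (x≤y⇒0≤y-x -s≤A)
    0≤B+t : 0# ≤ B + t
    0≤B+t = ≤-respʳ-≈ (+-congˡ (-‿involutive t)) (x≤y⇒0≤y-x -t≤B)
    upper : s * t ≤ A * B
    upper = 0≤y-x⇒x≤y (0≤two*x⇒0≤x (≤-respʳ-≈
      (solve 4 (λ A B s t → (A :- s) :* (B :+ t) :+ (A :+ s) :* (B :- t) := (con (+ 1) :+ con (+ 1)) :* (A :* B :- s :* t)) refl A B s t)
      (+-nonNeg (*-nonneg 0≤A-s 0≤B+t) (*-nonneg 0≤A+s 0≤B-t))))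
    lower : - (s * t) ≤ A * B
    lower = 0≤y-x⇒x≤y (0≤two*x⇒0≤x (≤-respʳ-≈
      (solve 4 (λ A B s t → (A :- s) :* (B :- t) :+ (A :+ s) :* (B :+ t) := (con (+ 1) :+ con (+ 1)) :* (A :* B :- :- (s :* t))) refl A B s t)
      (+-nonNeg (*-nonneg 0≤A-s 0≤B-t) (*-nonneg 0≤A+s 0≤B+t))))

  ∣x∣≤-between : ∀ {lo hi L H x} → ∣ lo ∣≤ L → ∣ hi ∣≤ H → lo ≤ x → x ≤ hi → ∣ x ∣≤ L + H
  ∣x∣≤-between {L = L} {H} ∣lo∣≤L ∣hi∣≤H lo≤x x≤hi =
    ≤-trans x≤hi (≤-trans (proj₁ ∣hi∣≤H) (≤-respˡ-≈ (+-identityˡ H) (+-monoˡ-≤ H (∣x∣≤M⇒0≤M ∣lo∣≤L)))) ,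
    ≤-trans (neg-antimono-≤ lo≤x) (≤-trans (proj₂ ∣lo∣≤L) (≤-respˡ-≈ (+-identityʳ L) (+-monoʳ-≤ L (∣x∣≤M⇒0≤M ∣hi∣≤H))))

  at-bounded : ∀ p lo hi → ∃ λ M → ∀ {x} → lo ≤ x → x ≤ hi → ∣ p at x ∣≤ M
  at-bounded []      lo hi = 0# , λ _ _ → ≤-refl , ≤-reflexive -0#≈0#
  at-bounded (a ∷ p) lo hi with ∣x∣≤-exists a | ∣x∣≤-exists lo | ∣x∣≤-exists hi | at-bounded p lo hi
  ... | A , ∣a∣≤A | L , ∣lo∣≤L | H , ∣hi∣≤H | M , ∣p∣≤M =
    A + (L + H) * M , λ lo≤x x≤hi → ∣x∣≤-+ ∣a∣≤A (∣x∣≤-* (∣x∣≤-between ∣lo∣≤L ∣hi∣≤H lo≤x x≤hi) (∣p∣≤M lo≤x x≤hi))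

  record Bracket (p : List Carrier) : Set (c ⊔ ℓ₂) where
    constructor bracket
    field
      lo hi   : Carrier
      lo≤hi   : lo ≤ hi
      p[lo]≤0 : p at lo ≤ 0#
      0≤p[hi] : 0# ≤ p at hi

  mid : Carrier → Carrier → Carrier
  mid l h = half * (l + h)

  two*mid≈l+h : ∀ l h → two * mid l h ≈ l + h
  two*mid≈l+h l h = trans (sym (*-assoc two half _)) (trans (*-congʳ two*half≈1) (*-identityˡ _))

  two*[mid-l]≈h-l : ∀ l h → two * (mid l h - l) ≈ h - l
  two*[mid-l]≈h-l l h = begin
    two * (m - l)        ≈⟨ solve 2 (λ m l → (con (+ 1) :+ con (+ 1)) :* (m :- l) := (con (+ 1) :+ con (+ 1)) :* m :- (l :+ l)) refl m l ⟩
    two * m - (l + l)    ≈⟨ +-congʳ (two*mid≈l+h l h) ⟩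
    (l + h) - (l + l)    ≈⟨ solve 2 (λ l h → (l :+ h) :- (l :+ l) := h :- l) refl l h ⟩
    h - l                ∎
    where m = mid l h

  two*[h-mid]≈h-l : ∀ l h → two * (h - mid l h) ≈ h - l
  two*[h-mid]≈h-l l h = begin
    two * (h - m)        ≈⟨ solve 2 (λ h m → (con (+ 1) :+ con (+ 1)) :* (h :- m) := (h :+ h) :- (con (+ 1) :+ con (+ 1)) :* m) refl h m ⟩
    (h + h) - two * m    ≈⟨ +-congˡ (-‿cong (two*mid≈l+h l h)) ⟩
    (h + h) - (l + h)    ≈⟨ solve 2 (λ l h → (h :+ h) :- (l :+ h) := h :- l) refl l h ⟩
    h - l                ∎
    where m = mid l h

  l≤mid : ∀ {l h} → l ≤ h → l ≤ mid l h
  l≤mid {l} {h} l≤h = 0≤y-x⇒x≤y (0≤two*x⇒0≤x (≤-respʳ-≈ (sym (two*[mid-l]≈h-l l h)) (x≤y⇒0≤y-x l≤h)))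

  mid≤h : ∀ {l h} → l ≤ h → mid l h ≤ h
  mid≤h {l} {h} l≤h = 0≤y-x⇒x≤y (0≤two*x⇒0≤x (≤-respʳ-≈ (sym (two*[h-mid]≈h-l l h)) (x≤y⇒0≤y-x l≤h)))

  bisect : ∀ {p} (b : Bracket p) → let open Bracket b in
           Σ (Bracket p) λ b′ → lo ≤ Bracket.lo b′ × Bracket.hi b′ ≤ hi × two * (Bracket.hi b′ - Bracket.lo b′) ≈ hi - lo
  bisect {p} (bracket l h l≤h p[l]≤0 0≤p[h]) = choose (total (p at mid l h) 0#)
    where
    choose : (p at mid l h ≤ 0#) ⊎ (0# ≤ p at mid l h) →
             Σ (Bracket p) λ b′ → l ≤ Bracket.lo b′ × Bracket.hi b′ ≤ h × two * (Bracket.hi b′ - Bracket.lo b′) ≈ h - l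
    choose (inj₁ p[m]≤0) = bracket (mid l h) h (mid≤h l≤h) p[m]≤0 0≤p[h] , l≤mid l≤h , ≤-refl , two*[h-mid]≈h-l l h
    choose (inj₂ 0≤p[m]) = bracket l (mid l h) (l≤mid l≤h) p[l]≤0 0≤p[m] , ≤-refl , mid≤h l≤h , two*[mid-l]≈h-l l h

  deflate-upper : ∀ p {r x M} → x ≤ r → p at x ≤ 0# → deflate r p at x ≤ M → p at r ≤ (r - x) * M
  deflate-upper p {r} {x} x≤r p[x]≤0 q[x]≤M = ≤-respˡ-≈ (sym p[r]≈) (≤-respʳ-≈ (+-identityˡ _)
    (+-mono-≤ p[x]≤0 (*-monoˡ-≤-nonNeg (r - x) (x≤y⇒0≤y-x x≤r) q[x]≤M)))
    where
    q = deflate r p at x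
    p[r]≈ : p at r ≈ p at x + (r - x) * q
    p[r]≈ = begin
      p at r                                ≈⟨ solve 4 (λ P x r Q → P := ((x :- r) :* Q :+ P) :+ (r :- x) :* Q) refl (p at r) x r q ⟩
      ((x - r) * q + p at r) + (r - x) * q  ≈⟨ +-congʳ (deflate-spec r p x) ⟨
      p at x + (r - x) * q                  ∎

  deflate-lower : ∀ p {r x M} → r ≤ x → 0# ≤ p at x → deflate r p at x ≤ M → - p at r ≤ (x - r) * M
  deflate-lower p {r} {x} r≤x 0≤p[x] q[x]≤M = ≤-respˡ-≈ (sym -p[r]≈) (≤-respʳ-≈ (+-identityˡ _)
    (+-mono-≤ (0≤x⇒-x≤0 0≤p[x]) (*-monoˡ-≤-nonNeg (x - r) (x≤y⇒0≤y-x r≤x) q[x]≤M)))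
    where
    q = deflate r p at x
    -p[r]≈ : - p at r ≈ - p at x + (x - r) * q
    -p[r]≈ = begin
      - p at r                                  ≈⟨ solve 4 (λ P x r Q → :- P := :- ((x :- r) :* Q :+ P) :+ (x :- r) :* Q) refl (p at r) x r q ⟩
      - ((x - r) * q + p at r) + (x - r) * q    ≈⟨ +-congʳ (-‿cong (deflate-spec r p x)) ⟨
      - p at x + (x - r) * q                    ∎

  module Bisection {p} (start : Bracket p) where

    brackets : ℕ → Bracket p
    brackets zero    = start
    brackets (suc k) = proj₁ (bisect (brackets k))

    lo hi : ℕ → Carrier
    lo k = Bracket.lo (brackets k)
    hi k = Bracket.hi (brackets k)

    lo-mono : ∀ i j → lo j ≤ lo (i ℕ.+ j)
    lo-mono zero    j = ≤-refl
    lo-mono (suc i) j = ≤-trans (lo-mono i j) (proj₁ (proj₂ (bisect (brackets (i ℕ.+ j)))))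

    hi-mono : ∀ i j → hi (i ℕ.+ j) ≤ hi j
    hi-mono zero    j = ≤-refl
    hi-mono (suc i) j = ≤-trans (proj₁ (proj₂ (proj₂ (bisect (brackets (i ℕ.+ j)))))) (hi-mono i j)

    lo₀≤lo : ∀ k → lo 0 ≤ lo k
    lo₀≤lo k = ≡.subst (λ n → lo 0 ≤ lo n) (ℕ.+-identityʳ k) (lo-mono k 0)

    hi≤hi₀ : ∀ k → hi k ≤ hi 0
    hi≤hi₀ k = ≡.subst (λ n → hi n ≤ hi 0) (ℕ.+-identityʳ k) (hi-mono k 0)

    lo≤hi : ∀ j k → lo j ≤ hi k
    lo≤hi j k = ≤-trans (lo-mono k j) (≤-trans (Bracket.lo≤hi (brackets (k ℕ.+ j)))
                  (≡.subst (λ n → hi n ≤ hi k) (ℕ.+-comm j k) (hi-mono j k)))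

    width-halves : ∀ k → two * (hi (suc k) - lo (suc k)) ≈ hi k - lo k
    width-halves k = proj₂ (proj₂ (proj₂ (bisect (brackets k))))

    Lows : Carrier → Set (c ⊔ ℓ₁ ⊔ ℓ₂)
    Lows x = Lift (c ⊔ ℓ₂) (∃ λ k → x ≈ lo k)

    supremum : Supremum Lows
    supremum = lub Lows (lo 0 , lift (0 , refl)) (hi 0 , λ { x (lift (k , x≈)) → ≤-respˡ-≈ (sym x≈) (lo≤hi k 0) })

    limit : Carrier
    limit = proj₁ supremum

    lo≤limit : ∀ k → lo k ≤ limit
    lo≤limit k = proj₁ (proj₂ supremum) (lo k) (lift (k , refl))

    limit≤hi : ∀ k → limit ≤ hi k
    limit≤hi k = proj₂ (proj₂ supremum) (hi k) λ { x (lift (j , x≈)) → ≤-respˡ-≈ (sym x≈) (lo≤hi j k) }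

  -- The root is the limit of the bisection. Dividing p by x − r bounds ∣ p r ∣ by the width of
  -- the k-th bracket times a bound of the quotient, and the widths halve.
  ivt : ∀ p {u v} → u ≤ v → p at u ≤ 0# → 0# ≤ p at v → ∃ λ r → u ≤ r × r ≤ v × p at r ≈ 0#
  ivt p {u} {v} u≤v p[u]≤0 0≤p[v] = r , lo≤limit 0 , limit≤hi 0 , antisym p[r]≤0 0≤p[r]
    where
    open Bisection {p} (bracket u v u≤v p[u]≤0 0≤p[v])
    r = limit

    bound : ∃ λ M → ∀ {x} → u ≤ x → x ≤ v → ∣ deflate r p at x ∣≤ M
    bound = at-bounded (deflate r p) u v

    M = proj₁ bound

    quotient-bounded : ∀ {x} k → lo k ≤ x → x ≤ hi k → ∣ deflate r p at x ∣≤ M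
    quotient-bounded k lo≤x x≤hi = proj₂ bound (≤-trans (lo₀≤lo k) lo≤x) (≤-trans x≤hi (hi≤hi₀ k))

    0≤M : 0# ≤ M
    0≤M = ∣x∣≤M⇒0≤M (quotient-bounded 0 ≤-refl (lo≤hi 0 0))

    width : ℕ → Carrier
    width k = (hi k - lo k) * M

    p[r]≤width : ∀ k → p at r ≤ width k
    p[r]≤width k = ≤-trans (deflate-upper p (lo≤limit k) (Bracket.p[lo]≤0 (brackets k)) (proj₁ (quotient-bounded k ≤-refl (lo≤hi k k))))
                           (*-monoʳ-≤-nonNeg M 0≤M (+-monoˡ-≤ (- lo k) (limit≤hi k)))

    -p[r]≤width : ∀ k → - p at r ≤ width k
    -p[r]≤width k = ≤-trans (deflate-lower p (limit≤hi k) (Bracket.0≤p[hi] (brackets k)) (proj₁ (quotient-bounded k (lo≤hi k k) ≤-refl)))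
                            (*-monoʳ-≤-nonNeg M 0≤M (+-monoʳ-≤ (hi k) (neg-antimono-≤ (lo≤limit k))))

    width-halves′ : ∀ k → two * width (suc k) ≈ width k
    width-halves′ k = trans (sym (*-assoc two _ M)) (*-congʳ (width-halves k))

    p[r]≤0 : p at r ≤ 0#
    p[r]≤0 = ≤-halvings⇒≤0 width width-halves′ p[r]≤width

    0≤p[r] : 0# ≤ p at r
    0≤p[r] = ≤-respʳ-≈ (-‿involutive _) (x≤0⇒0≤-x (≤-halvings⇒≤0 width width-halves′ -p[r]≤width))

  ivt-strict : ∀ p {u v} → u < v → (p at u < 0# × 0# < p at v) ⊎ (0# < p at u × p at v < 0#) →
               ∃ λ r → u < r × r < v × p at r ≈ 0#
  ivt-strict p {u} {v} u<v (inj₁ (p[u]<0 , 0<p[v])) = strict (ivt p (<⇒≤ u<v) (<⇒≤ p[u]<0) (<⇒≤ 0<p[v]))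
    where
    strict : (∃ λ r → u ≤ r × r ≤ v × p at r ≈ 0#) → ∃ λ r → u < r × r < v × p at r ≈ 0#
    strict (r , u≤r , r≤v , p[r]≈0) =
      r , (λ r≤u → <⇒≉ p[u]<0 (trans (at-cong p (antisym u≤r r≤u)) p[r]≈0))
        , (λ v≤r → <⇒≉ 0<p[v] (sym (trans (at-cong p (antisym v≤r r≤v)) p[r]≈0)))
        , p[r]≈0
  ivt-strict p {u} {v} u<v (inj₂ (0<p[u] , p[v]<0)) = unnegate (ivt-strict (negate p) u<v (inj₁ (-p[u]<0 , 0<-p[v])))
    where
    -p[u]<0 : negate p at u < 0#
    -p[u]<0 = <-respˡ-≈ (sym (negate-at p u)) (0<-x⇒x<0 (<-respʳ-≈ (sym (-‿involutive _)) 0<p[u]))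
    0<-p[v] : 0# < negate p at v
    0<-p[v] = <-respʳ-≈ (sym (negate-at p v)) (x<0⇒0<-x p[v]<0)
    unnegate : (∃ λ r → u < r × r < v × negate p at r ≈ 0#) → ∃ λ r → u < r × r < v × p at r ≈ 0#
    unnegate (r , u<r , r<v , -p[r]≈0) = r , u<r , r<v , (begin
      p at r           ≈⟨ -‿involutive _ ⟨
      - - p at r       ≈⟨ -‿cong (trans (sym (negate-at p r)) -p[r]≈0) ⟩
      - 0#             ≈⟨ -0#≈0# ⟩
      0#               ∎)

module Interlacing {c ℓ₁ ℓ₂} (R : RealField c ℓ₁ ℓ₂) where
  open RealField R hiding (_≤_; +-mono-≤)
  open OrderedField R
  open Completeness R
  open IntegerSolver commRing
  open Polynomials commRing using (_at_; leading; IsRoot; deflate; deflate-root; deflateAll; length-deflateAll; leading-deflateAll)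
  open import Relation.Binary.Reasoning.Setoid setoid

  Sorted : List Carrier → Set (c ⊔ ℓ₂)
  Sorted = AllPairs _<_

  All-<-trans : ∀ {x y} {zs : List Carrier} → x < y → All (y <_) zs → All (x <_) zs
  All-<-trans x<y = All.map (<-trans x<y)

  deflateAll-factorises : ∀ rs p → AllPairs (λ s t → ¬ s ≈ t) rs → All (IsRoot p) rs →
                          ∀ x → p at x ≈ deflateAll rs p at x * linProd R rs x
  deflateAll-factorises []       p []                  []               x = sym (*-identityʳ _)
  deflateAll-factorises (r ∷ rs) p (r≉rs ∷ distinct) (p[r]≈0 ∷ roots) x = begin
    p at x                    ≈⟨ deflate-root p p[r]≈0 x ⟩
    (x - r) * q at x          ≈⟨ *-congˡ (deflateAll-factorises rs q distinct (roots-of-quotient r≉rs roots) x) ⟩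
    (x - r) * (D * ∏)         ≈⟨ solve 3 (λ a D P → a :* (D :* P) := D :* (a :* P)) refl (x - r) D ∏ ⟩
    D * ((x - r) * ∏)         ∎
    where
    q = deflate r p
    D = deflateAll rs q at x
    ∏ = linProd R rs x
    roots-of-quotient : ∀ {ts} → All (λ t → ¬ r ≈ t) ts → All (IsRoot p) ts → All (IsRoot q) ts
    roots-of-quotient []                  []               = []
    roots-of-quotient {t ∷ _} (r≉t ∷ r≉ts) (p[t]≈0 ∷ roots) =
      x≉0∧xy≈0⇒y≈0 t-r≉0 (trans (sym (deflate-root p p[r]≈0 t)) p[t]≈0) ∷ roots-of-quotient r≉ts roots
      where
      t-r≉0 : ¬ (t - r) ≈ 0#
      t-r≉0 t-r≈0 = r≉t (sym (trans (solve 2 (λ t r → t := (t :- r) :+ r) refl t r) (trans (+-congʳ t-r≈0) (+-identityˡ r))))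

  linear-form : ∀ q → length q ≡ 2 → ¬ leading q ≈ 0# → ∃ λ ρ → ∀ x → q at x ≈ leading q * (x - ρ)
  linear-form (β ∷ α ∷ []) _ α≉0 = - (β * α⁻¹) , λ x → begin
    β + x * (α + x * 0#)          ≈⟨ solve 3 (λ β α x → β :+ x :* (α :+ x :* con (+ 0)) := α :* x :+ β :* con (+ 1)) refl β α x ⟩
    α * x + β * 1#                ≈⟨ +-congˡ (*-congˡ (sym αα⁻¹≈1)) ⟩
    α * x + β * (α * α⁻¹)         ≈⟨ solve 4 (λ β α x α⁻¹ → α :* x :+ β :* (α :* α⁻¹) := α :* (x :- :- (β :* α⁻¹))) refl β α x α⁻¹ ⟩
    α * (x - - (β * α⁻¹))         ∎
    where
    α⁻¹ = proj₁ (inverse α α≉0)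
    αα⁻¹≈1 : α * α⁻¹ ≈ 1#
    αα⁻¹≈1 = proj₂ (inverse α α≉0)

  linProd-sign : ∀ {u} ts → All (u <_) ts → HasSign (length ts) (linProd R ts u)
  linProd-sign []       []           = 0<1
  linProd-sign (t ∷ ts) (u<t ∷ u<ts) = HasSign-*neg (length ts) (x<y⇒x-y<0 u<t) (linProd-sign ts u<ts)

  linProd-roots : ∀ rs → All (λ r → linProd R rs r ≈ 0#) rs
  linProd-roots []       = []
  linProd-roots (r ∷ rs) =
    trans (*-congʳ (-‿inverseʳ r)) (zeroˡ _) ∷ All.map (λ ∏≈0 → trans (*-congˡ ∏≈0) (zeroʳ _)) (linProd-roots rs)

  data Alternates (f : Carrier → Carrier) (o : ℕ) : List Carrier → Set (c ⊔ ℓ₂) where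
    []  : Alternates f o []
    _∷_ : ∀ {u us} → HasSign (o ℕ.+ length us) (f u) → Alternates f o us → Alternates f o (u ∷ us)

  Alternates-map : ∀ {p} {P : Carrier → Set p} {f g o o′ us} →
                   (∀ {u} n → P u → HasSign (o ℕ.+ n) (f u) → HasSign (o′ ℕ.+ n) (g u)) →
                   All P us → Alternates f o us → Alternates g o′ us
  Alternates-map step []         []            = []
  Alternates-map step (Pu ∷ Pus) (fu ∷ fus) = step _ Pu fu ∷ Alternates-map step Pus fus

  linProd-alternates : ∀ ts rs → Sorted (interleave ts rs) → length ts ≡ suc (length rs) → Alternates (linProd R rs) 0 ts
  linProd-alternates (t ∷ [])     []       _                               _   = 0<1 ∷ []
  linProd-alternates (t ∷ ts)     (r ∷ rs) ((t<r ∷ t<rest) ∷ r<rest ∷ sorted) len =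
    ≡.subst (λ n → HasSign n (linProd R (r ∷ rs) t)) (≡.sym (ℕ.suc-injective len))
            (linProd-sign (r ∷ rs) (t<r ∷ proj₂ (All-interleave⁻ ts rs t<rest)))
    ∷ Alternates-map (λ n r<u → HasSign-*pos n (x<y⇒0<y-x r<u))
                     (proj₁ (All-interleave⁻ ts rs r<rest))
                     (linProd-alternates ts rs sorted (ℕ.suc-injective len))

  roots-between : ∀ p u us v → Sorted (u ∷ us) → All (_< v) (u ∷ us) → Alternates (p at_) 1 (u ∷ us) → 0# < p at v →
            ∃ λ ts → length ts ≡ length (u ∷ us) × Sorted (u ∷ interleave ts us) × All (_< v) ts × All (IsRoot p) ts
  roots-between p u [] v _ (u<v ∷ []) (p[u]<0 ∷ []) 0<p[v] = single (ivt-strict p u<v (inj₁ (p[u]<0 , 0<p[v])))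
    where
    single : (∃ λ t → u < t × t < v × IsRoot p t) →
             ∃ λ ts → length ts ≡ 1 × Sorted (u ∷ interleave ts []) × All (_< v) ts × All (IsRoot p) ts
    single (t , u<t , t<v , root) = t ∷ [] , ≡.refl , (u<t ∷ []) ∷ [] ∷ [] , t<v ∷ [] , root ∷ []
  roots-between p u (u′ ∷ us) v ((u<u′ ∷ _) ∷ sorted) (_ ∷ below@(u′<v ∷ _)) (p[u] ∷ p[u′] ∷ alternates) 0<p[v] =
    extend (ivt-strict p u<u′ (HasSign-opposite (suc (length us)) p[u] p[u′]))
           (roots-between p u′ us v sorted below (p[u′] ∷ alternates) 0<p[v])
    where
    extend : (∃ λ t → u < t × t < u′ × IsRoot p t) →
             (∃ λ ts → length ts ≡ length (u′ ∷ us) × Sorted (u′ ∷ interleave ts us) × All (_< v) ts × All (IsRoot p) ts) →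
             ∃ λ ts → length ts ≡ length (u ∷ u′ ∷ us) × Sorted (u ∷ interleave ts (u′ ∷ us)) × All (_< v) ts × All (IsRoot p) ts
    extend (t , u<t , t<u′ , root) (ts , len , sorted′@(u′<rest ∷ _) , ts<v , roots) =
      t ∷ ts , ≡.cong suc len ,
      (u<t ∷ u<u′ ∷ All-<-trans u<u′ u′<rest) ∷ (t<u′ ∷ All-<-trans t<u′ u′<rest) ∷ sorted′ ,
      <-trans t<u′ u′<v ∷ ts<v , root ∷ roots

  remaining-root : ∀ p ts → length p ≡ suc (suc (length ts)) → 0# < leading p → Sorted ts → All (IsRoot p) ts →
              ∀ {w} → All (w <_) ts → HasSign (length ts) (p at w) →
              ∃ λ ρ → ρ < w × ∀ x → p at x ≈ leading p * linProd R (ρ ∷ ts) x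
  remaining-root p ts len 0<lead sorted roots {w} w<ts p[w] = ρ , ρ<w , factorisation
    where
    q = deflateAll ts p
    length-q : length q ≡ 2
    length-q = ≡.trans (length-deflateAll ts p) (≡.trans (≡.cong (ℕ._∸ length ts) len) (ℕ.m+n∸n≡m 2 (length ts)))
    leading-q : leading q ≈ leading p
    leading-q = leading-deflateAll ts p (≡.subst (length ts ℕ.<_) (≡.sym len) (s≤s (ℕ.n≤1+n _)))
    linear : ∃ λ ρ → ∀ x → q at x ≈ leading q * (x - ρ)
    linear = linear-form q length-q (λ lead≈0 → <⇒≉ 0<lead (sym (trans (sym leading-q) lead≈0)))
    ρ = proj₁ linear
    factorisation : ∀ x → p at x ≈ leading p * linProd R (ρ ∷ ts) x
    factorisation x = begin
      p at x                              ≈⟨ deflateAll-factorises ts p (AllPairs.map <⇒≉ sorted) roots x ⟩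
      q at x * linProd R ts x             ≈⟨ *-congʳ (proj₂ linear x) ⟩
      leading q * (x - ρ) * linProd R ts x ≈⟨ *-assoc _ _ _ ⟩
      leading q * linProd R (ρ ∷ ts) x    ≈⟨ *-congʳ leading-q ⟩
      leading p * linProd R (ρ ∷ ts) x    ∎
    ρ<w : ρ < w
    ρ<w = 0<y-x⇒x<y (HasSign-*pos⁻¹ 0 0<lead (HasSign-same⇒pos (length ts)
            (HasSign-resp (length ts) (trans (factorisation w) (sym (*-assoc _ _ _))) p[w]) (linProd-sign ts w<ts)))

  -- The sign changes between consecutive points of us and v give length us roots; dividing them out
  -- leaves a linear factor of positive slope, whose root lies below the first point.
  alternating⇒splits : ∀ p us v → length p ≡ suc (suc (length us)) → 0# < leading p → Sorted us → All (_< v) us →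
          Alternates (p at_) 1 us → 0# < p at v →
          ∃ λ ts → length ts ≡ suc (length us) × Sorted (interleave ts us) × All (_< v) ts ×
                   ∀ x → p at x ≈ leading p * linProd R ts x
  alternating⇒splits p [] v len 0<lead [] [] [] 0<p[v] = lowest (remaining-root p [] len 0<lead [] [] [] 0<p[v])
    where
    lowest : (∃ λ ρ → ρ < v × ∀ x → p at x ≈ leading p * linProd R (ρ ∷ []) x) →
             ∃ λ ts → length ts ≡ 1 × Sorted (interleave ts []) × All (_< v) ts × ∀ x → p at x ≈ leading p * linProd R ts x
    lowest (ρ , ρ<v , factorisation) = ρ ∷ [] , ≡.refl , [] ∷ [] , ρ<v ∷ [] , factorisation
  alternating⇒splits p (u ∷ us) v len 0<lead sorted below alternates@(p[u] ∷ _) 0<p[v] =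
    lowest (roots-between p u us v sorted below alternates 0<p[v])
    where
    lowest : (∃ λ ts → length ts ≡ length (u ∷ us) × Sorted (u ∷ interleave ts us) × All (_< v) ts × All (IsRoot p) ts) →
             ∃ λ ts → length ts ≡ suc (length (u ∷ us)) × Sorted (interleave ts (u ∷ us)) × All (_< v) ts ×
                      ∀ x → p at x ≈ leading p * linProd R ts x
    lowest (ts , len-ts , sorted′@(u<rest ∷ rest-sorted) , ts<v , roots) = finish (remaining-root p ts
        (≡.trans len (≡.cong (λ n → suc (suc n)) (≡.sym len-ts))) 0<lead
        (proj₁ (AllPairs-interleave⁻ ts us rest-sorted)) roots
        (proj₁ (All-interleave⁻ ts us u<rest))
        (≡.subst (λ n → HasSign n (p at u)) (≡.sym len-ts) p[u]))
      where
      finish : (∃ λ ρ → ρ < u × ∀ x → p at x ≈ leading p * linProd R (ρ ∷ ts) x) →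
               ∃ λ ts′ → length ts′ ≡ suc (length (u ∷ us)) × Sorted (interleave ts′ (u ∷ us)) × All (_< v) ts′ ×
                         ∀ x → p at x ≈ leading p * linProd R ts′ x
      finish (ρ , ρ<u , factorisation) =
        ρ ∷ ts , ≡.cong suc len-ts , (ρ<u ∷ All-<-trans ρ<u u<rest) ∷ sorted′ ,
        <-trans ρ<u (All.head below) ∷ ts<v , factorisation

module RealRootedness {c ℓ₁ ℓ₂} (R : RealField c ℓ₁ ℓ₂) where
  open RealField R hiding (_≤_; +-mono-≤)
  open OrderedField R
  open IntegerSolver commRing
  open Polynomials commRing
  open UniformPolynomials commRing
  open Interlacing R
  open import Relation.Binary.Reasoning.Setoid setoid

  0≤ι : ∀ n → 0# ≤ ι n
  0≤ι zero    = ≤-refl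
  0≤ι (suc n) = <⇒≤ (+-pos-nonNeg 0<1 (0≤ι n))

  0<ι[1+n] : ∀ n → 0# < ι (suc n)
  0<ι[1+n] n = +-pos-nonNeg 0<1 (0≤ι n)

  0<ι : ∀ {n} → 0 ℕ.< n → 0# < ι n
  0<ι {suc n} _ = 0<ι[1+n] n

  module _ (a b : ℕ) (a≤b : a ℕ.≤ b) where

    0<E[−1] : ∀ {k} → k ℕ.≤ a → 0# < E a b k at (- 1#)
    0<E[−1] {k} k≤a = <-respʳ-≈ (sym (E-at-−1 a b k)) (0<ι (nCk>0 k≤a))

    0<leading-E : ∀ {k} → k ℕ.≤ b → 0# < leading (E a b k)
    0<leading-E {k} k≤b = <-respʳ-≈ (reflexive (≡.sym (≡.trans (leading-poly (coeffE a b k) k) (≡.cong ι top≡))))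
                                      (0<ι (nCk>0 k≤b))
      where
      top≡ : coeffE a b k k ≡ b C k
      top≡ = ≡.trans (≡.cong ((b C k) ℕ.*_) (C[k⊖k]≡1 _ k)) (ℕ.*-identityʳ (b C k))

    sign-flip-at-root : ∀ {k u} → k ℕ.≤ a → IsRoot (E a b k) u → u < - 1# →
                        ∀ n → HasSign n (E′ a b k u) → HasSign (suc n) (E a b (suc k) at u)
    sign-flip-at-root {k} {u} k≤a E[u]≈0 u<−1 n sign =
      HasSign-*pos⁻¹ (suc n) (0<ι[1+n] k)
        (HasSign-resp (suc n) (sym recurrence) (HasSign-*pos (suc n) 0<coefficient (HasSign-*neg n 1+u<0 sign)))
      where
      coefficient : Carrier
      coefficient = ((ι a + ι b) + 1#) - ι k
      0<coefficient : 0# < coefficient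
      0<coefficient = <-respʳ-≈ (sym (trans (solve 3 (λ A B K → ((A :+ B) :+ con (+ 1)) :- K := (con (+ 1) :+ B) :+ (A :- K)) refl (ι a) (ι b) (ι k))
                                              (+-congˡ (ι-∸ k≤a))))
                                 (+-pos-nonNeg (0<ι[1+n] b) (0≤ι (a ℕ.∸ k)))
      1+u<0 : 1# + u < 0#
      1+u<0 = <-respˡ-≈ (solve 1 (λ u → u :- :- con (+ 1) := con (+ 1) :+ u) refl u) (x<y⇒x-y<0 u<−1)
      recurrence : ι (suc k) * E a b (suc k) at u ≈ coefficient * ((1# + u) * E′ a b k u)
      recurrence = begin
        ι (suc k) * E a b (suc k) at u
          ≈⟨ E-recurrence a b k u ⟩
        ((ι a - ι k) + (ι b - ι k) * (1# + u)) * E a b k at u + coefficient * ((1# + u) * E′ a b k u)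
          ≈⟨ +-congʳ (trans (*-congˡ E[u]≈0) (zeroʳ _)) ⟩
        0# + coefficient * ((1# + u) * E′ a b k u)
          ≈⟨ +-identityˡ _ ⟩
        coefficient * ((1# + u) * E′ a b k u) ∎

    record RootData (k : ℕ) : Set (c ⊔ ℓ₁ ⊔ ℓ₂) where
      field
        roots               : List Carrier
        length-roots        : length roots ≡ k
        sorted              : Sorted roots
        below−1             : All (_< - 1#) roots
        factorises          : ∀ x → E a b k at x ≈ leading (E a b k) * linProd R roots x
        previous-alternates : Alternates (E′ a b k) 0 roots

    rootData₀ : RootData 0
    rootData₀ = record
      { roots = [] ; length-roots = ≡.refl ; sorted = [] ; below−1 = []
      ; factorises = λ x → trans (+-congˡ (zeroʳ x)) (trans (+-identityʳ _) (sym (*-identityʳ _)))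
      ; previous-alternates = [] }

    rootData-step : ∀ {k} → suc k ℕ.≤ a → RootData k → RootData (suc k)
    rootData-step {k} k<a rootData = interlace
      (alternating⇒splits (E a b (suc k)) roots (- 1#) length-E (0<leading-E (ℕ.≤-trans k<a a≤b)) sorted below−1 next-alternates (0<E[−1] k<a))
      where
      open RootData rootData
      k≤a : k ℕ.≤ a
      k≤a = ℕ.<⇒≤ k<a
      length-E : length (E a b (suc k)) ≡ suc (suc (length roots))
      length-E = ≡.trans (length-applyUpTo (λ j → ι (coeffE a b (suc k) j)) (suc (suc k)))
                         (≡.cong (λ n → suc (suc n)) (≡.sym length-roots))
      zeros : All (IsRoot (E a b k)) roots
      zeros = All.map (λ {r} ∏≈0 → trans (factorises r) (trans (*-congˡ ∏≈0) (zeroʳ _))) (linProd-roots roots)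
      next-alternates : Alternates (E a b (suc k) at_) 1 roots
      next-alternates = Alternates-map (λ n (root , r<−1) → sign-flip-at-root k≤a root r<−1 n) (All.zip (zeros , below−1)) previous-alternates
      interlace : (∃ λ ts → length ts ≡ suc (length roots) × Sorted (interleave ts roots) × All (_< - 1#) ts ×
                            ∀ x → E a b (suc k) at x ≈ leading (E a b (suc k)) * linProd R ts x) → RootData (suc k)
      interlace (ts , length-ts , interlaced , ts<−1 , factorisation) = record
        { roots = ts ; length-roots = ≡.trans length-ts (≡.cong suc length-roots)
        ; sorted = proj₁ (AllPairs-interleave⁻ ts roots interlaced) ; below−1 = ts<−1 ; factorises = factorisation
        ; previous-alternates = Alternates-map (λ {u} n _ sign → HasSign-resp n (sym (factorises u)) (HasSign-*pos n 0<leading sign))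
                                  (All.universal-U ts) (linProd-alternates ts roots interlaced length-ts) }
        where
        0<leading : 0# < leading (E a b k)
        0<leading = 0<leading-E (ℕ.≤-trans k≤a a≤b)

    E-real-rooted : ∀ k → k ℕ.≤ a → RootData k
    E-real-rooted zero    _   = rootData₀
    E-real-rooted (suc k) k<a = rootData-step k<a (E-real-rooted k (ℕ.<⇒≤ k<a))

  ι≈Defs-ι : ∀ n → Defs.ι R n ≈ ι n
  ι≈Defs-ι zero    = refl
  ι≈Defs-ι (suc n) = +-congˡ (ι≈Defs-ι n)

  eval≈poly : ∀ f n x → eval R (applyUpTo f n) x ≈ poly f n at x
  eval≈poly f zero    x = refl
  eval≈poly f (suc n) x = +-cong (ι≈Defs-ι (f 0)) (*-congˡ (eval≈poly (λ j → f (suc j)) n x))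

  gPoly≈t*E : ∀ a b m M → suc a ℕ.⊓ (suc a ℕ.+ suc b ℕ.∸ suc a) ≡ suc m →
              (∀ {j} → j ℕ.≤ m → gcoef (suc a ℕ.+ suc b) (suc a) (suc j) ≡ coeffE m M m j) →
              ∀ t → eval R (gPoly (suc a ℕ.+ suc b) (suc a)) t ≈ t * E m M m at t
  gPoly≈t*E a b m M length≡ coefficients t = begin
    eval R (gPoly (suc a ℕ.+ suc b) (suc a)) t       ≡⟨ ≡.cong (λ l → eval R (map g (upTo (suc l))) t) length≡ ⟩
    eval R (map g (upTo (suc (suc m)))) t            ≡⟨ ≡.cong (λ l → eval R l t) (map-upTo g (suc (suc m))) ⟩
    eval R (applyUpTo g (suc (suc m))) t             ≈⟨ eval≈poly g (suc (suc m)) t ⟩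
    0# + t * poly (λ j → g (suc j)) (suc m) at t     ≈⟨ +-identityˡ _ ⟩
    t * poly (λ j → g (suc j)) (suc m) at t          ≡⟨ ≡.cong (λ l → t * l at t) (poly-cong (suc m) (λ { (s≤s j≤m) → coefficients j≤m })) ⟩
    t * E m M m at t                                 ∎
    where
    g = gcoef (suc a ℕ.+ suc b) (suc a)

  OnlyRealZeros-from-E : ∀ p m M → m ℕ.≤ M → (∀ t → eval R p t ≈ t * E m M m at t) → OnlyRealZeros R p
  OnlyRealZeros-from-E p m M m≤M p≈t*E = leading (E m M m) , 0# ∷ roots , λ t → begin
    eval R p t                                   ≈⟨ p≈t*E t ⟩
    t * E m M m at t                             ≈⟨ *-congˡ (factorises t) ⟩
    t * (leading (E m M m) * linProd R roots t)  ≈⟨ solve 3 (λ t c P → t :* (c :* P) := c :* ((t :- con (+ 0)) :* P)) refl t _ _ ⟩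
    leading (E m M m) * linProd R (0# ∷ roots) t ∎
    where open RootData (E-real-rooted m M m≤M m ℕ.≤-refl)

  g-real-rooted : ∀ a b → OnlyRealZeros R (gPoly (suc a ℕ.+ suc b) (suc a))
  g-real-rooted a b with ℕ.≤-total a b
  ... | inj₁ a≤b = OnlyRealZeros-from-E (gPoly (suc a ℕ.+ suc b) (suc a)) a b a≤b
        (gPoly≈t*E a b a b (≡.trans (≡.cong (suc a ℕ.⊓_) (ℕ.m+n∸m≡n a (suc b))) (ℕ.m≤n⇒m⊓n≡m (s≤s a≤b)))
                           (λ j≤a → gcoef≡coeffE j≤a a≤b))
  ... | inj₂ b≤a = OnlyRealZeros-from-E (gPoly (suc a ℕ.+ suc b) (suc a)) b a b≤a
        (gPoly≈t*E a b b a (≡.trans (≡.cong (suc a ℕ.⊓_) (ℕ.m+n∸m≡n a (suc b))) (ℕ.m≥n⇒m⊓n≡n (s≤s b≤a)))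
                           (λ j≤b → gcoef≡coeffE-swapped j≤b b≤a))

open import Data.Nat using (_≤_; _∸_)

theorem3p1 : ∀ {c ℓ₁ ℓ₂ : Level} (R : RealField c ℓ₁ ℓ₂) (n d : ℕ) →
    2 ≤ n → 1 ≤ d → d ≤ n ∸ 1 → OnlyRealZeros R (gPoly n d)
theorem3p1 R (suc n) (suc a) _ _ a<n =
  ≡.subst (λ m → OnlyRealZeros R (gPoly m (suc a))) d+[n-d]≡n (RealRootedness.g-real-rooted R a (n ∸ suc a))
  where
  d+[n-d]≡n : suc a ℕ.+ suc (n ∸ suc a) ≡ suc n
  d+[n-d]≡n = ≡.cong suc (≡.trans (ℕ.+-suc a _) (ℕ.m+[n∸m]≡n a<n))
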